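{- For all integers $n\ge 0$, \[ o_E(\Gamma_n,1) = \frac{1-(-1)^n}{2}F_{\lfloor \frac{n+1}{2}\rfloor}, \] \[ o_E(\Gamma_n,2) = \frac{1}{10}\big(nF_{n+1} + 2(n+1)F_n\big) - \frac{1-(-1)^n}{4}F_{\lfloor \frac{n+1}{2}\rfloor}, \] \[ o_E(\Gamma_n) = \frac{1}{10}\big(nF_{n+1} + 2(n+1)F_n\big) + \frac{1-(-1)^n}{4}F_{\lfloor \frac{n+1}{2}\rfloor}. \]
   Context: The Fibonacci cube $\Gamma_n$ is the subgraph of the $n$-cube $Q_n$ (binary strings of length $n$, adjacent iff they differ in exactly one position) induced by the binary strings of length $n$ with no two consecutive 1s ($\Gamma_0$ has the single vertex given by the empty string). For a graph $G$, $o_E(G)$ is the number of orbits of ${\rm Aut}(G)$ acting on $E(G)$ via $\{u,v\}\mapsto\{g(u),g(v)\}$ and $o_E(G,k)$ is the number of such orbits of size $k$. $F_m$ are Fibonacci numbers with $F_0=0$, $F_1=1$. -}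

module Defs where

open import Data.Nat using (ℕ; zero; suc; _+_; _*_; ⌊_/2⌋; _%_)
open import Data.Bool using (Bool; true; false; T; _∧_; not; _xor_; if_then_else_)
open import Data.Unit using (⊤)
open import Level using (Level; _⊔_)
open import Data.Vec using (Vec; []; _∷_)
open import Data.Product using (Σ; _×_; _,_; proj₁; proj₂; ∃)
open import Data.Sum using (_⊎_)
open import Data.List using (List; length)
open import Data.List.Relation.Unary.All using (All)
open import Data.List.Relation.Unary.Any using (Any)
open import Data.List.Relation.Unary.AllPairs using (AllPairs)
open import Relation.Nullary using (¬_)
open import Relation.Binary.PropositionalEquality using (_≡_)
open import Function.Bundles using (_↔_; _⇔_; Inverse; Equivalence)

F : ℕ → ℕ
F zero = 0
F (suc zero) = 1
F (suc (suc m)) = F (suc m) + F m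

-- Edges: pairs (u , v) with u adjacent to v; {u,v} = {v,u} is handled by SameEdge
Edge : (V : Set) → (V → V → Set) → Set
Edge V Adj = Σ (V × V) (λ p → Adj (proj₁ p) (proj₂ p))

SameEdge : {V : Set} {Adj : V → V → Set} → Edge V Adj → Edge V Adj → Set
SameEdge ((u , v) , _) ((u' , v') , _) = (u ≡ u' × v ≡ v') ⊎ (u ≡ v' × v ≡ u')

record Aut (V : Set) (Adj : V → V → Set) : Set₁ where
  field
    bij      : V ↔ V
    preserve : ∀ u v → Adj u v ⇔ Adj (Inverse.to bij u) (Inverse.to bij v)

act : {V : Set} {Adj : V → V → Set} → Aut V Adj → Edge V Adj → Edge V Adj
act g ((u , v) , a) =
  (Inverse.to (Aut.bij g) u , Inverse.to (Aut.bij g) v)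
  , Equivalence.to (Aut.preserve g u v) a

SameOrbit : {V : Set} {Adj : V → V → Set} → Edge V Adj → Edge V Adj → Set₁
SameOrbit {V} {Adj} e e' = Σ (Aut V Adj) (λ g → SameEdge (act g e) e')

-- "The number of R-classes of elements satisfying P is k":
-- a list of k elements satisfying P, pairwise not R-related,
-- such that every element satisfying P is R-related to one in the list.
-- (Used with R an equivalence relation and P closed under R.)
CountClasses : {ℓ ℓ' ℓ'' : Level} {A : Set ℓ} → (A → A → Set ℓ') → (A → Set ℓ'') → ℕ → Set (ℓ ⊔ ℓ' ⊔ ℓ'')
CountClasses {A = A} R P k =
  Σ (List A) (λ L →
    (length L ≡ k) × All P L × AllPairs (λ a b → ¬ R a b) L
    × (∀ x → P x → Any (R x) L))

-- |orbit of e| = k  (number of distinct edges {u,v} in the orbit of e)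
OrbitSize : {V : Set} {Adj : V → V → Set} → Edge V Adj → ℕ → Set₁
OrbitSize e k = CountClasses SameEdge (SameOrbit e) k

OE : (V : Set) (Adj : V → V → Set) → ℕ → Set₁
OE V Adj m = CountClasses {A = Edge V Adj} SameOrbit (λ _ → ⊤) m

OEk : (V : Set) (Adj : V → V → Set) → ℕ → ℕ → Set₁
OEk V Adj k m = CountClasses {A = Edge V Adj} SameOrbit (λ e → OrbitSize e k) m

noConsec : {n : ℕ} → Vec Bool n → Bool
noConsec [] = true
noConsec (_ ∷ []) = true
noConsec (b ∷ c ∷ w) = not (b ∧ c) ∧ noConsec (c ∷ w)

hamming : {n : ℕ} → Vec Bool n → Vec Bool n → ℕ
hamming [] [] = 0
hamming (b ∷ u) (c ∷ v) = (if b xor c then 1 else 0) + hamming u v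

ΓV : ℕ → Set
ΓV n = Σ (Vec Bool n) (λ w → T (noConsec w))

ΓAdj : (n : ℕ) → ΓV n → ΓV n → Set
ΓAdj n (u , _) (v , _) = hamming u v ≡ 1

module Submission where

-- Every edge of Γ_n is {u , u + e_i} for a unique code (u , i) with u_i = 0,
-- and reversal of words acts on codes as an involution.  The heart of the
-- proof is that for n ≥ 2 the only automorphisms of Γ_n are the identity and
-- the reversal: an automorphism fixes the zero word (the only vertex of
-- degree n), so it permutes the unit words e_i along an automorphism of the
-- path 0 - 1 - ... - (n-1); and an automorphism fixing 0 and every e_i fixes
-- every vertex, by induction on the weight.  Hence the edge orbits are the
-- reversal orbits of codes.  A general counting lemma for involutions gives
-- #codes = #fixed codes + 2 #two-element orbits; the codes satisfy a
-- Fibonacci recurrence giving 5 |E(Γ_n)| = n F(n+1) + 2 (n+1) F(n), and the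
-- fixed codes are the palindromic ones, (n mod 2) F(⌊(n+1)/2⌋) in number.

open import Defs
open import Data.Nat using (ℕ; zero; suc; _+_; _*_; _%_; ⌊_/2⌋; _<_; s≤s; s≤s⁻¹)
import Data.Nat.Properties as ℕ
open import Data.Nat.Properties
  using (suc-injective; +-comm; +-assoc; +-identityʳ; *-distribˡ-+;
         1+n≰n; 1+n≢n; m≤n⇒m<n∨m≡n; n<1+n; <-trans)
open import Data.Nat.Solver using (module +-*-Solver)
open import Data.Bool using (Bool; true; false; T; not; _∧_; _xor_; if_then_else_)
import Data.Bool.Properties as Bool
open import Data.Bool.Properties
  using (T-irrelevant; T-∧; not-involutive; not-¬; ∧-identityˡ; ∧-identityʳ; ∧-zeroʳ; ∧-assoc; ∧-comm)
open import Data.Fin using (Fin; zero; suc; toℕ; fromℕ; fromℕ<; inject₁; opposite; punchOut)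
import Data.Fin.Properties as Fin
open import Data.Fin.Properties
  using (toℕ-injective; toℕ<n; toℕ-fromℕ; toℕ-fromℕ<; punchOut-injective; injective⇒≤)
open import Data.Vec using (Vec; []; _∷_; lookup; updateAt; replicate; reverse; _∷ʳ_; initLast)
import Data.Vec as Vec
open import Data.Vec.Properties
  using (≡-dec; updateAt-updateAt; updateAt-id-local; updateAt-commutes; lookup∘updateAt; lookup∘updateAt′;
         reverse-∷; reverse-involutive; ∷-injective; ∷ʳ-injective)
open import Data.List using (List; []; _∷_; length; map; filter; _++_)
open import Data.List.Properties using (length-++; length-map)
open import Data.List.Membership.Propositional using (_∈_; _∉_)
open import Data.List.Membership.Propositional.Properties
  using (∈-map⁺; ∈-map⁻; ∈-++⁺ˡ; ∈-++⁺ʳ; ∈-++⁻; ∈-filter⁺; ∈-filter⁻)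
open import Data.List.Membership.Propositional.Properties.WithK using (unique∧set⇒bag)
open import Data.List.Relation.Binary.BagAndSetEquality using (∼bag⇒↭)
open import Data.List.Relation.Binary.Permutation.Propositional.Properties using (↭-length)
open import Data.List.Relation.Binary.Disjoint.Propositional using (Disjoint)
open import Data.List.Relation.Unary.All as All using (All; []; _∷_)
import Data.List.Relation.Unary.All.Properties as Allₚ
open import Data.List.Relation.Unary.Any as Any using (Any; here; there)
import Data.List.Relation.Unary.Any.Properties as Anyₚ
open import Data.List.Relation.Unary.AllPairs as AllPairs using (AllPairs; []; _∷_)
import Data.List.Relation.Unary.AllPairs.Properties as AllPairsₚ
open import Data.List.Relation.Unary.Unique.Propositional using (Unique)
import Data.List.Relation.Unary.Unique.Propositional.Properties as Uniqueₚ
open import Data.Product using (Σ; _×_; _,_; proj₁; proj₂)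
open import Data.Sum as Sum using (_⊎_; inj₁; inj₂)
open import Data.Unit using (⊤; tt)
open import Data.Empty using (⊥; ⊥-elim)
open import Function using (_∘_; _∘′_)
open import Function.Bundles using (_⇔_; Inverse; Equivalence; mk↔ₛ′; mk⇔)
open import Function.Construct.Identity using (↔-id; ⇔-id)
open import Function.Construct.Composition using (_↔-∘_; _⇔-∘_)
open import Function.Construct.Symmetry using (↔-sym)
open import Relation.Nullary using (¬_; Dec; yes; no)
open import Relation.Binary.Definitions using (DecidableEquality)
open import Relation.Binary.PropositionalEquality
open import Relation.Binary.PropositionalEquality.WithK using (≡-irrelevant)

private variable n m : ℕ

uniqueLength : {A : Set} {xs ys : List A} → Unique xs → Unique ys →
               (∀ {x} → x ∈ xs ⇔ x ∈ ys) → length xs ≡ length ys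
uniqueLength uxs uys same = ↭-length (∼bag⇒↭ (unique∧set⇒bag uxs uys same))

map-disjoint : {X Y A : Set} (h : X → A) (k : Y → A) → (∀ x y → h x ≢ k y) →
               {xs : List X} {ys : List Y} → Disjoint (map h xs) (map k ys)
map-disjoint h k h≢k (m , m′) with ∈-map⁻ h m | ∈-map⁻ k m′
... | x , _ , refl | y , _ , e = h≢k x y e

module InvolutionOrbits {A : Set} (_≟_ : DecidableEquality A)
                        (r : A → A) (r-involutive : ∀ x → r (r x) ≡ x) where

  open import Data.List.Membership.DecPropositional _≟_ using (_∈?_)

  Fixed : A → Set
  Fixed x = r x ≡ x

  _~_ : A → A → Set
  x ~ y = y ≡ x ⊎ y ≡ r x

  r-injective : ∀ {x y} → r x ≡ r y → x ≡ y
  r-injective {x} {y} e = trans (sym (r-involutive x)) (trans (cong r e) (r-involutive y))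

  r-nonFixed : ∀ {x} → ¬ Fixed x → ¬ Fixed (r x)
  r-nonFixed nf f = nf (r-injective f)

  fixedPoints : List A → List A
  fixedPoints = filter (λ x → r x ≟ x)

  representatives : List A → List A
  representatives [] = []
  representatives (x ∷ xs) with r x ≟ x | r x ∈? xs
  ... | yes _ | _     = representatives xs
  ... | no _  | yes _ = representatives xs
  ... | no _  | no _  = x ∷ representatives xs

  representative-sound : ∀ {y} xs → y ∈ representatives xs → y ∈ xs × ¬ Fixed y
  representative-sound (x ∷ xs) m with r x ≟ x | r x ∈? xs
  ... | yes _ | _     = let (m′ , nf) = representative-sound xs m in there m′ , nf
  ... | no _  | yes _ = let (m′ , nf) = representative-sound xs m in there m′ , nf
  representative-sound (x ∷ xs) (here refl) | no nf | no _ = here refl , nf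
  representative-sound (x ∷ xs) (there m)   | no _  | no _ =
    let (m′ , nf) = representative-sound xs m in there m′ , nf

  representatives-pairwise : ∀ xs → Unique xs → AllPairs (λ a b → ¬ a ~ b) (representatives xs)
  representatives-pairwise [] [] = []
  representatives-pairwise (x ∷ xs) (x∉xs ∷ u) with r x ≟ x | r x ∈? xs
  ... | yes _ | _        = representatives-pairwise xs u
  ... | no _  | yes _    = representatives-pairwise xs u
  ... | no _  | no rx∉xs =
    All.tabulate unrelated ∷ representatives-pairwise xs u
    where
    unrelated : ∀ {b} → b ∈ representatives xs → ¬ x ~ b
    unrelated m (inj₁ refl) = All.lookup x∉xs (proj₁ (representative-sound xs m)) refl
    unrelated m (inj₂ refl) = rx∉xs (proj₁ (representative-sound xs m))

  representative-partner : ∀ {y} xs → Unique xs → y ∈ representatives xs →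
                           r y ∉ representatives xs
  representative-partner (x ∷ xs) (_ ∷ u) m m′ with r x ≟ x | r x ∈? xs
  ... | yes _ | _        = representative-partner xs u m m′
  ... | no _  | yes _    = representative-partner xs u m m′
  ... | no nf | no rx∉xs with m | m′
  ...   | here refl | here e  = nf e
  ...   | here refl | there k = rx∉xs (proj₁ (representative-sound xs k))
  ...   | there k   | here e  = rx∉xs (subst (_∈ xs) (trans (sym (r-involutive _)) (cong r e))
                                             (proj₁ (representative-sound xs k)))
  ...   | there k   | there k′ = representative-partner xs u k k′

  representative-cover : ∀ {y} xs → Unique xs → y ∈ xs → ¬ Fixed y →
                         y ∈ representatives xs ⊎ r y ∈ representatives xs
  representative-cover (x ∷ xs) (x∉xs ∷ u) m nfy with r x ≟ x | r x ∈? xs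
  ... | yes f | _ with m
  ...   | here refl = ⊥-elim (nfy f)
  ...   | there k   = representative-cover xs u k nfy
  representative-cover (x ∷ xs) (x∉xs ∷ u) m nfy | no _ | yes rx∈xs with m
  ...   | there k   = representative-cover xs u k nfy
  ...   | here refl with representative-cover xs u rx∈xs (r-nonFixed nfy)
  ...     | inj₁ k = inj₂ k
  ...     | inj₂ k = ⊥-elim (All.lookup x∉xs (subst (_∈ xs) (r-involutive x)
                                  (proj₁ (representative-sound xs k))) refl)
  representative-cover (x ∷ xs) (x∉xs ∷ u) m nfy | no _ | no _ with m
  ...   | here refl = inj₁ (here refl)
  ...   | there k with representative-cover xs u k nfy
  ...     | inj₁ k′ = inj₁ (there k′)
  ...     | inj₂ k′ = inj₂ (there k′)

  -- For a duplicate-free list L containing every element, the fixed points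
  -- together with the representatives and their partners list every
  -- element exactly once, so  |L| = |fixed points| + 2 |representatives|.
  module Complete (L : List A) (L-unique : Unique L) (L-complete : ∀ x → x ∈ L) where

    Fix Rep : List A
    Fix = fixedPoints L
    Rep = representatives L

    fixed-sound : ∀ {y} → y ∈ Fix → Fixed y
    fixed-sound m = proj₂ (∈-filter⁻ (λ x → r x ≟ x) {xs = L} m)

    representative-nonFixed : ∀ {y} → y ∈ Rep → ¬ Fixed y
    representative-nonFixed m = proj₂ (representative-sound L m)

    Fix-pairwise : AllPairs (λ a b → ¬ a ~ b) Fix
    Fix-pairwise = fixed-pairwise Fix (Uniqueₚ.filter⁺ _ L-unique) (All.tabulate fixed-sound)
      where
      fixed-pairwise : ∀ xs → Unique xs → All Fixed xs → AllPairs (λ a b → ¬ a ~ b) xs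
      fixed-pairwise [] [] [] = []
      fixed-pairwise (x ∷ xs) (x∉xs ∷ u) (fx ∷ fxs) =
        All.map (λ x≢b → λ { (inj₁ e) → x≢b (sym e) ; (inj₂ e) → x≢b (sym (trans e fx)) }) x∉xs
        ∷ fixed-pairwise xs u fxs

    Rep-pairwise : AllPairs (λ a b → ¬ a ~ b) Rep
    Rep-pairwise = representatives-pairwise L L-unique

    Fix-length : ∀ {P} → Unique P → (∀ {x} → x ∈ P ⇔ Fixed x) → length Fix ≡ length P
    Fix-length P-unique P⇔Fixed = uniqueLength (Uniqueₚ.filter⁺ _ L-unique) P-unique (mk⇔
      (λ m → Equivalence.from P⇔Fixed (fixed-sound m))
      (λ m → ∈-filter⁺ (λ x → r x ≟ x) (L-complete _) (Equivalence.to P⇔Fixed m)))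

    Rep-unique : Unique Rep
    Rep-unique = AllPairs.map (λ ¬a~b a≡b → ¬a~b (inj₁ (sym a≡b))) Rep-pairwise

    Rep-disjoint-partners : ∀ {y} → y ∈ Rep → y ∈ map r Rep → ⊥
    Rep-disjoint-partners m m′ with ∈-map⁻ r m′
    ... | _ , k , refl = representative-partner L L-unique k m

    Fix-disjoint : ∀ {y} → y ∈ Fix → y ∈ Rep ++ map r Rep → ⊥
    Fix-disjoint m m′ with ∈-++⁻ Rep m′
    ... | inj₁ k = representative-nonFixed k (fixed-sound m)
    ... | inj₂ k with ∈-map⁻ r k
    ...   | _ , kz , refl = r-nonFixed (representative-nonFixed kz) (fixed-sound m)

    partition-unique : Unique (Fix ++ (Rep ++ map r Rep))
    partition-unique =
      Uniqueₚ.++⁺ (Uniqueₚ.filter⁺ _ L-unique)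
        (Uniqueₚ.++⁺ Rep-unique (Uniqueₚ.map⁺ r-injective Rep-unique)
          λ (m , m′) → Rep-disjoint-partners m m′)
        λ (m , m′) → Fix-disjoint m m′

    partition-complete : ∀ y → y ∈ Fix ++ (Rep ++ map r Rep)
    partition-complete y with r y ≟ y
    ... | yes f = ∈-++⁺ˡ (∈-filter⁺ (λ x → r x ≟ x) (L-complete y) f)
    ... | no nf with representative-cover L L-unique (L-complete y) nf
    ...   | inj₁ m = ∈-++⁺ʳ Fix (∈-++⁺ˡ m)
    ...   | inj₂ m = ∈-++⁺ʳ Fix (∈-++⁺ʳ Rep (subst (_∈ map r Rep) (r-involutive y) (∈-map⁺ r m)))

    orbit-count : length L ≡ length Fix + 2 * length Rep
    orbit-count = begin
      length L
        ≡⟨ uniqueLength L-unique partition-unique (mk⇔ (λ _ → partition-complete _) (λ _ → L-complete _)) ⟩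
      length (Fix ++ (Rep ++ map r Rep))
        ≡⟨ trans (length-++ Fix) (cong (length Fix +_) (length-++ Rep)) ⟩
      length Fix + (length Rep + length (map r Rep))
        ≡⟨ cong (λ k → length Fix + (length Rep + k)) (trans (length-map r Rep) (sym (+-identityʳ _))) ⟩
      length Fix + 2 * length Rep  ∎
      where open ≡-Reasoning

    classes-pairwise : AllPairs (λ a b → ¬ a ~ b) (Fix ++ Rep)
    classes-pairwise = AllPairsₚ.++⁺ Fix-pairwise Rep-pairwise
      (All.tabulate λ mf → All.tabulate λ mr → fixed-unrelated (fixed-sound mf) (representative-nonFixed mr))
      where
      fixed-unrelated : ∀ {a b} → Fixed a → ¬ Fixed b → ¬ a ~ b
      fixed-unrelated fa nfb (inj₁ refl) = nfb fa
      fixed-unrelated fa nfb (inj₂ refl) = nfb (cong r fa)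

    fixed-cover : ∀ {y} → Fixed y → Any (y ~_) Fix
    fixed-cover {y} f = Any.map (λ e → inj₁ (sym e)) (∈-filter⁺ (λ x → r x ≟ x) (L-complete y) f)

    nonFixed-cover : ∀ {y} → ¬ Fixed y → Any (y ~_) Rep
    nonFixed-cover {y} nf with representative-cover L L-unique (L-complete y) nf
    ... | inj₁ m = Any.map (λ e → inj₁ (sym e)) m
    ... | inj₂ m = Any.map (λ e → inj₂ (sym e)) m

module _ {V : Set} {Adj : V → V → Set} where

  app : Aut V Adj → V → V
  app g = Inverse.to (Aut.bij g)

  app-adj : (g : Aut V Adj) {x y : V} → Adj x y → Adj (app g x) (app g y)
  app-adj g {x} {y} = Equivalence.to (Aut.preserve g x y)

  inverseAut : Aut V Adj → Aut V Adj
  inverseAut g = record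
    { bij = ↔-sym (Aut.bij g)
    ; preserve = λ x y → mk⇔
        (λ a → Equivalence.from (Aut.preserve g (from x) (from y))
                 (subst₂ Adj (sym (to∘from x)) (sym (to∘from y)) a))
        (λ a → subst₂ Adj (to∘from x) (to∘from y) (Equivalence.to (Aut.preserve g (from x) (from y)) a))
    }
    where
    from : V → V
    from = Inverse.from (Aut.bij g)
    to∘from : ∀ x → app g (from x) ≡ x
    to∘from = Inverse.strictlyInverseˡ (Aut.bij g)

  app-inverseˡ : (g : Aut V Adj) (x : V) → app g (app (inverseAut g) x) ≡ x
  app-inverseˡ g = Inverse.strictlyInverseˡ (Aut.bij g)

  app-inverseʳ : (g : Aut V Adj) (x : V) → app (inverseAut g) (app g x) ≡ x
  app-inverseʳ g = Inverse.strictlyInverseʳ (Aut.bij g)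

  app-injective : (g : Aut V Adj) {x y : V} → app g x ≡ app g y → x ≡ y
  app-injective g {x} {y} e =
    trans (sym (app-inverseʳ g x)) (trans (cong (app (inverseAut g)) e) (app-inverseʳ g y))

  composeAut : Aut V Adj → Aut V Adj → Aut V Adj
  composeAut h g = record
    { bij = Aut.bij h ↔-∘ Aut.bij g
    ; preserve = λ x y → Aut.preserve h (app g x) (app g y) ⇔-∘ Aut.preserve g x y
    }

module EdgeFacts (V : Set) (Adj : V → V → Set) where

  private
    E : Set
    E = Edge V Adj

  sameEdge-refl : (x : E) → SameEdge x x
  sameEdge-refl x = inj₁ (refl , refl)

  -- (SameEdge reduces on its arguments, so they are passed explicitly)
  sameEdge-sym : (x y : E) → SameEdge x y → SameEdge y x
  sameEdge-sym _ _ (inj₁ (a , b)) = inj₁ (sym a , sym b)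
  sameEdge-sym _ _ (inj₂ (a , b)) = inj₂ (sym b , sym a)

  sameEdge-trans : (x y z : E) → SameEdge x y → SameEdge y z → SameEdge x z
  sameEdge-trans _ _ _ (inj₁ (a , b)) (inj₁ (c , d)) = inj₁ (trans a c , trans b d)
  sameEdge-trans _ _ _ (inj₁ (a , b)) (inj₂ (c , d)) = inj₂ (trans a c , trans b d)
  sameEdge-trans _ _ _ (inj₂ (a , b)) (inj₁ (c , d)) = inj₂ (trans a d , trans b c)
  sameEdge-trans _ _ _ (inj₂ (a , b)) (inj₂ (c , d)) = inj₁ (trans a d , trans b c)

  act-sameEdge : (g : Aut V Adj) (x y : E) → SameEdge x y → SameEdge (act g x) (act g y)
  act-sameEdge g _ _ (inj₁ (a , b)) = inj₁ (cong (app g) a , cong (app g) b)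
  act-sameEdge g _ _ (inj₂ (a , b)) = inj₂ (cong (app g) a , cong (app g) b)

  identityAut : Aut V Adj
  identityAut = record { bij = ↔-id V ; preserve = λ _ _ → ⇔-id _ }

  sameOrbit-refl : (x : E) → SameOrbit x x
  sameOrbit-refl x = identityAut , sameEdge-refl x

  sameOrbit-resp : (x x′ y y′ : E) → SameEdge x x′ → SameEdge y y′ → SameOrbit x y → SameOrbit x′ y′
  sameOrbit-resp x x′ y y′ xx′ yy′ (g , s) =
    g , sameEdge-trans (act g x′) (act g x) y′ (act-sameEdge g x′ x (sameEdge-sym x x′ xx′))
                       (sameEdge-trans (act g x) y y′ s yy′)

-- Suppose every edge
-- is coded by exactly one element of C (up to SameEdge), and two coded
-- edges lie in the same orbit exactly when their codes lie in the same
-- orbit of an involution r.  Then orbits of size 1 correspond to fixed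
-- codes and orbits of size 2 to two-element r-orbits.
module OrbitsFromCoding
  {V : Set} {Adj : V → V → Set} {C : Set} (_≟_ : DecidableEquality C)
  (r : C → C) (r-involutive : ∀ c → r (r c) ≡ c)
  (edge : C → Edge V Adj)
  (edge-surjective : ∀ x → Σ C λ c → SameEdge x (edge c))
  (edge-injective : ∀ c d → SameEdge (edge c) (edge d) → c ≡ d)
  (orbit-partner : ∀ c → SameOrbit (edge c) (edge (r c)))
  (orbit-sound : ∀ c d → SameOrbit (edge c) (edge d) → d ≡ c ⊎ d ≡ r c)
  (codes : List C) (codes-unique : Unique codes) (codes-complete : ∀ c → c ∈ codes)
  where

  open EdgeFacts V Adj
  open InvolutionOrbits _≟_ r r-involutive
  open Complete codes codes-unique codes-complete public

  private
    E : Set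
    E = Edge V Adj

  orbit-codes : (x y : E) (c d : C) → SameEdge x (edge c) → SameEdge y (edge d) →
                SameOrbit x y → c ~ d
  orbit-codes x y c d xc yd o = orbit-sound c d (sameOrbit-resp x (edge c) y (edge d) xc yd o)

  codes-orbit : (x y : E) (c d : C) → SameEdge x (edge c) → SameEdge y (edge d) →
                c ~ d → SameOrbit x y
  codes-orbit x y c d xc yd c~d =
    sameOrbit-resp (edge c) x (edge d) y (sameEdge-sym x (edge c) xc) (sameEdge-sym y (edge d) yd)
      (coded c~d)
    where
    coded : c ~ d → SameOrbit (edge c) (edge d)
    coded (inj₁ refl) = sameOrbit-refl (edge c)
    coded (inj₂ refl) = orbit-partner c

  fixed-orbit : ∀ {c} (x y : E) → Fixed c → SameEdge x (edge c) → SameOrbit x y → SameEdge y (edge c)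
  fixed-orbit {c} x y f xc o with edge-surjective y
  ... | d , yd with orbit-codes x y c d xc yd o
  ...   | inj₁ refl = yd
  ...   | inj₂ refl = subst (λ e → SameEdge y (edge e)) f yd

  orbitSize-fixed : ∀ c → Fixed c → OrbitSize (edge c) 1
  orbitSize-fixed c f =
    (edge c ∷ []) , refl , (sameOrbit-refl (edge c) ∷ []) , ([] ∷ []) ,
    λ y o → here (fixed-orbit (edge c) y f (sameEdge-refl (edge c)) o)

  orbitSize-nonFixed : ∀ c → ¬ Fixed c → OrbitSize (edge c) 2
  orbitSize-nonFixed c nf =
    (edge c ∷ edge (r c) ∷ []) , refl ,
    (sameOrbit-refl (edge c) ∷ orbit-partner c ∷ []) ,
    (((λ s → nf (sym (edge-injective c (r c) s))) ∷ []) ∷ [] ∷ []) , cover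
    where
    cover : ∀ y → SameOrbit (edge c) y → Any (SameEdge y) (edge c ∷ edge (r c) ∷ [])
    cover y o with edge-surjective y
    ... | d , yd with orbit-codes (edge c) y c d (sameEdge-refl (edge c)) yd o
    ...   | inj₁ refl = here yd
    ...   | inj₂ refl = there (here yd)

  size1-fixed : ∀ {c} (x : E) → SameEdge x (edge c) → OrbitSize x 1 → Fixed c
  size1-fixed {c} x xc ((l ∷ []) , refl , _ , _ , cover)
    with cover (edge c) (codes-orbit x (edge c) c c xc (sameEdge-refl (edge c)) (inj₁ refl))
       | cover (edge (r c)) (codes-orbit x (edge (r c)) c (r c) xc (sameEdge-refl (edge (r c))) (inj₂ refl))
  ... | here cl | here rcl =
    edge-injective (r c) c (sameEdge-trans (edge (r c)) l (edge c) rcl (sameEdge-sym (edge c) l cl))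

  size2-nonFixed : ∀ {c} (x : E) → SameEdge x (edge c) → OrbitSize x 2 → ¬ Fixed c
  size2-nonFixed {c} x xc ((a ∷ b ∷ []) , refl , (oa ∷ ob ∷ []) , ((a≁b ∷ []) ∷ _) , _) f =
    a≁b (sameEdge-trans a (edge c) b (fixed-orbit x a f xc oa)
                        (sameEdge-sym b (edge c) (fixed-orbit x b f xc ob)))

  lift-pairwise : ∀ {cs} → AllPairs (λ a b → ¬ a ~ b) cs →
                  AllPairs (λ x y → ¬ SameOrbit x y) (map edge cs)
  lift-pairwise ap = AllPairsₚ.map⁺ (AllPairs.map
    (λ {a} {b} a≁b o → a≁b (orbit-codes (edge a) (edge b) a b (sameEdge-refl (edge a)) (sameEdge-refl (edge b)) o))
    ap)

  lift-cover : ∀ {c cs} (x : E) → SameEdge x (edge c) → Any (c ~_) cs → Any (SameOrbit x) (map edge cs)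
  lift-cover {c} x xc = Anyₚ.map⁺ ∘′ Any.map (λ {d} → codes-orbit x (edge d) c d xc (sameEdge-refl (edge d)))

  orbits-size1 : OEk V Adj 1 (length Fix)
  orbits-size1 =
    map edge Fix , length-map edge Fix ,
    Allₚ.map⁺ (All.tabulate (λ m → orbitSize-fixed _ (fixed-sound m))) , lift-pairwise Fix-pairwise ,
    λ x s → let (c , xc) = edge-surjective x in lift-cover x xc (fixed-cover (size1-fixed x xc s))

  orbits-size2 : OEk V Adj 2 (length Rep)
  orbits-size2 =
    map edge Rep , length-map edge Rep ,
    Allₚ.map⁺ (All.tabulate (λ m → orbitSize-nonFixed _ (representative-nonFixed m))) ,
    lift-pairwise Rep-pairwise ,
    λ x s → let (c , xc) = edge-surjective x in lift-cover x xc (nonFixed-cover (size2-nonFixed x xc s))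

  orbits-all : OE V Adj (length Fix + length Rep)
  orbits-all =
    map edge (Fix ++ Rep) , trans (length-map edge (Fix ++ Rep)) (length-++ Fix) ,
    All.tabulate (λ _ → tt) , lift-pairwise classes-pairwise , cover
    where
    cover : ∀ x → ⊤ → Any (SameOrbit x) (map edge (Fix ++ Rep))
    cover x _ with edge-surjective x
    ... | c , xc with r c ≟ c
    ...   | yes f  = lift-cover x xc (Anyₚ.++⁺ˡ (fixed-cover f))
    ...   | no nf = lift-cover x xc (Anyₚ.++⁺ʳ Fix (nonFixed-cover nf))

false≢true : false ≢ true
false≢true ()

zero≢suc : {i : Fin n} → Fin.zero ≢ suc i
zero≢suc ()

toggle : Vec Bool n → Fin n → Vec Bool n
toggle u i = updateAt u i not

toggle-involutive : (u : Vec Bool n) (i : Fin n) → toggle (toggle u i) i ≡ u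
toggle-involutive u i = trans (updateAt-updateAt i u) (updateAt-id-local i u (not-involutive _))

toggle-comm : (u : Vec Bool n) (i j : Fin n) → toggle (toggle u i) j ≡ toggle (toggle u j) i
toggle-comm u i j with i Fin.≟ j
... | yes refl = refl
... | no i≢j = updateAt-commutes j i (λ j≡i → i≢j (sym j≡i)) u

lookup-toggle : (u : Vec Bool n) (i : Fin n) → lookup (toggle u i) i ≡ not (lookup u i)
lookup-toggle u i = lookup∘updateAt i u

lookup-toggle-other : (u : Vec Bool n) {i j : Fin n} → i ≢ j → lookup (toggle u i) j ≡ lookup u j
lookup-toggle-other u {i} {j} i≢j = lookup∘updateAt′ j i (λ j≡i → i≢j (sym j≡i)) u

toggle-injective : (u : Vec Bool n) (i j : Fin n) → toggle u i ≡ toggle u j → i ≡ j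
toggle-injective u i j e with i Fin.≟ j
... | yes i≡j = i≡j
... | no i≢j = ⊥-elim (not-¬ refl (sym (begin
  not (lookup u i)        ≡⟨ sym (lookup-toggle u i) ⟩
  lookup (toggle u i) i   ≡⟨ cong (λ w → lookup w i) e ⟩
  lookup (toggle u j) i   ≡⟨ lookup-toggle-other u (λ j≡i → i≢j (sym j≡i)) ⟩
  lookup u i              ∎)))
  where open ≡-Reasoning

hamming-same : ∀ b (u v : Vec Bool n) → hamming (b ∷ u) (b ∷ v) ≡ hamming u v
hamming-same true  u v = refl
hamming-same false u v = refl

hamming-notˡ : ∀ b (u v : Vec Bool n) → hamming (not b ∷ u) (b ∷ v) ≡ suc (hamming u v)
hamming-notˡ true  u v = refl
hamming-notˡ false u v = refl

hamming-notʳ : ∀ b (u v : Vec Bool n) → hamming (b ∷ u) (not b ∷ v) ≡ suc (hamming u v)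
hamming-notʳ true  u v = refl
hamming-notʳ false u v = refl

hamming-self : (u : Vec Bool n) → hamming u u ≡ 0
hamming-self [] = refl
hamming-self (b ∷ u) = trans (hamming-same b u u) (hamming-self u)

hamming≡0 : (u v : Vec Bool n) → hamming u v ≡ 0 → u ≡ v
hamming≡0 [] [] _ = refl
hamming≡0 (true  ∷ u) (true  ∷ v) h = cong (true ∷_) (hamming≡0 u v h)
hamming≡0 (false ∷ u) (false ∷ v) h = cong (false ∷_) (hamming≡0 u v h)

hamming-toggle : (u : Vec Bool n) (i : Fin n) → hamming u (toggle u i) ≡ 1
hamming-toggle (b ∷ u) zero = trans (hamming-notʳ b u u) (cong suc (hamming-self u))
hamming-toggle (b ∷ u) (suc i) = trans (hamming-same b u (toggle u i)) (hamming-toggle u i)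

hamming≡1 : (u v : Vec Bool n) → hamming u v ≡ 1 → Σ (Fin n) λ i → v ≡ toggle u i
hamming≡1 [] [] ()
hamming≡1 (true  ∷ u) (true  ∷ v) h = let (i , e) = hamming≡1 u v h in suc i , cong (true ∷_) e
hamming≡1 (false ∷ u) (false ∷ v) h = let (i , e) = hamming≡1 u v h in suc i , cong (false ∷_) e
hamming≡1 (true  ∷ u) (false ∷ v) h = zero , cong (false ∷_) (sym (hamming≡0 u v (suc-injective h)))
hamming≡1 (false ∷ u) (true  ∷ v) h = zero , cong (true ∷_) (sym (hamming≡0 u v (suc-injective h)))

common-neighbour-bit : (u : Vec Bool n) (i j k : Fin n) → i ≢ j →
                       hamming (toggle (toggle u i) j) (toggle u k) ≡ 1 → k ≡ i ⊎ k ≡ j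
common-neighbour-bit (b ∷ u) zero zero k i≢j h = ⊥-elim (i≢j refl)
common-neighbour-bit (b ∷ u) zero (suc j) zero i≢j h = inj₁ refl
common-neighbour-bit (b ∷ u) zero (suc j) (suc k) i≢j h =
  inj₂ (cong suc (sym (toggle-injective u j k
    (hamming≡0 _ _ (suc-injective (trans (sym (hamming-notˡ b (toggle u j) (toggle u k))) h))))))
common-neighbour-bit (b ∷ u) (suc i) zero zero i≢j h = inj₂ refl
common-neighbour-bit (b ∷ u) (suc i) zero (suc k) i≢j h =
  inj₁ (cong suc (sym (toggle-injective u i k
    (hamming≡0 _ _ (suc-injective (trans (sym (hamming-notˡ b (toggle u i) (toggle u k))) h))))))
common-neighbour-bit (b ∷ u) (suc i) (suc j) zero i≢j h =
  ⊥-elim (i≢j (cong suc (toggle-injective u i j (begin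
    toggle u i                          ≡⟨ sym (toggle-involutive (toggle u i) j) ⟩
    toggle (toggle (toggle u i) j) j    ≡⟨ cong (λ w → toggle w j) ij≡u ⟩
    toggle u j                          ∎))))
  where
  open ≡-Reasoning
  ij≡u : toggle (toggle u i) j ≡ u
  ij≡u = hamming≡0 _ _ (suc-injective (trans (sym (hamming-notʳ b (toggle (toggle u i) j) u)) h))
common-neighbour-bit (b ∷ u) (suc i) (suc j) (suc k) i≢j h
  with common-neighbour-bit u i j k (λ i≡j → i≢j (cong suc i≡j))
         (trans (sym (hamming-same b (toggle (toggle u i) j) (toggle u k))) h)
... | inj₁ k≡i = inj₁ (cong suc k≡i)
... | inj₂ k≡j = inj₂ (cong suc k≡j)

common-neighbours : (u x : Vec Bool n) (i j : Fin n) → i ≢ j → hamming u x ≡ 1 →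
                    hamming (toggle (toggle u i) j) x ≡ 1 → x ≡ toggle u i ⊎ x ≡ toggle u j
common-neighbours u x i j i≢j ux h with hamming≡1 u x ux
... | k , refl with common-neighbour-bit u i j k i≢j h
...   | inj₁ refl = inj₁ refl
...   | inj₂ refl = inj₂ refl

toggle-∷ʳ-inject : (u : Vec Bool n) (x : Bool) (j : Fin n) → toggle (u ∷ʳ x) (inject₁ j) ≡ toggle u j ∷ʳ x
toggle-∷ʳ-inject (y ∷ u) x zero = refl
toggle-∷ʳ-inject (y ∷ u) x (suc j) = cong (y ∷_) (toggle-∷ʳ-inject u x j)

toggle-∷ʳ-last : (u : Vec Bool n) (x : Bool) → toggle (u ∷ʳ x) (fromℕ n) ≡ u ∷ʳ not x
toggle-∷ʳ-last [] x = refl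
toggle-∷ʳ-last (y ∷ u) x = cong (y ∷_) (toggle-∷ʳ-last u x)

toggle-reverse : (u : Vec Bool n) (i : Fin n) → toggle (reverse u) (opposite i) ≡ reverse (toggle u i)
toggle-reverse (x ∷ u) zero rewrite reverse-∷ x u | reverse-∷ (not x) u = toggle-∷ʳ-last (reverse u) x
toggle-reverse (x ∷ u) (suc i) rewrite reverse-∷ x u | reverse-∷ x (toggle u i) =
  trans (toggle-∷ʳ-inject (reverse u) x (opposite i)) (cong (_∷ʳ x) (toggle-reverse u i))

lookup-∷ʳ-inject₁ : (u : Vec Bool n) (x : Bool) (j : Fin n) → lookup (u ∷ʳ x) (inject₁ j) ≡ lookup u j
lookup-∷ʳ-inject₁ (y ∷ u) x zero = refl
lookup-∷ʳ-inject₁ (y ∷ u) x (suc j) = lookup-∷ʳ-inject₁ u x j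

lookup-reverse : (u : Vec Bool n) (i : Fin n) → lookup (reverse u) (opposite i) ≡ lookup u i
lookup-reverse (x ∷ u) zero rewrite reverse-∷ x u = lookup-last (reverse u)
  where
  lookup-last : ∀ {m} (w : Vec Bool m) → lookup (w ∷ʳ x) (fromℕ m) ≡ x
  lookup-last [] = refl
  lookup-last (y ∷ w) = lookup-last w
lookup-reverse (x ∷ u) (suc i) rewrite reverse-∷ x u =
  trans (lookup-∷ʳ-inject₁ (reverse u) x (opposite i)) (lookup-reverse u i)

hamming-∷ʳ : (u v : Vec Bool n) (a b : Bool) →
             hamming (u ∷ʳ a) (v ∷ʳ b) ≡ hamming (a ∷ u) (b ∷ v)
hamming-∷ʳ [] [] a b = refl
hamming-∷ʳ (x ∷ u) (y ∷ v) a b = begin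
  d x y + hamming (u ∷ʳ a) (v ∷ʳ b)   ≡⟨ cong (d x y +_) (hamming-∷ʳ u v a b) ⟩
  d x y + (d a b + hamming u v)       ≡⟨ sym (+-assoc (d x y) _ _) ⟩
  d x y + d a b + hamming u v         ≡⟨ cong (_+ hamming u v) (+-comm (d x y) (d a b)) ⟩
  d a b + d x y + hamming u v         ≡⟨ +-assoc (d a b) _ _ ⟩
  d a b + (d x y + hamming u v)       ∎
  where
  open ≡-Reasoning
  d : Bool → Bool → ℕ
  d p q = if p xor q then 1 else 0

hamming-reverse : (u v : Vec Bool n) → hamming (reverse u) (reverse v) ≡ hamming u v
hamming-reverse [] [] = refl
hamming-reverse (x ∷ u) (y ∷ v) rewrite reverse-∷ x u | reverse-∷ y v =
  trans (hamming-∷ʳ (reverse u) (reverse v) x y)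
        (cong ((if x xor y then 1 else 0) +_) (hamming-reverse u v))

Valid : Vec Bool n → Set
Valid u = T (noConsec u)

-- first and last letter of a word (false for the empty word)
headOr : Vec Bool n → Bool
headOr [] = false
headOr (b ∷ _) = b

lastOr : Vec Bool n → Bool
lastOr [] = false
lastOr (x ∷ []) = x
lastOr (x ∷ y ∷ u) = lastOr (y ∷ u)

noConsec-false∷ : (u : Vec Bool n) → noConsec (false ∷ u) ≡ noConsec u
noConsec-false∷ [] = refl
noConsec-false∷ (c ∷ u) = refl

noConsec-∷ : ∀ b (u : Vec Bool n) → noConsec (b ∷ u) ≡ not (b ∧ headOr u) ∧ noConsec u
noConsec-∷ true [] = refl
noConsec-∷ false [] = refl
noConsec-∷ b (c ∷ u) = refl

noConsec-∷ʳ : (u : Vec Bool n) (b : Bool) → noConsec (u ∷ʳ b) ≡ noConsec u ∧ not (lastOr u ∧ b)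
noConsec-∷ʳ [] b = refl
noConsec-∷ʳ (x ∷ []) b = trans (∧-identityʳ _) (sym (∧-identityˡ _))
noConsec-∷ʳ (x ∷ y ∷ w) b =
  trans (cong (not (x ∧ y) ∧_) (noConsec-∷ʳ (y ∷ w) b)) (sym (∧-assoc (not (x ∧ y)) _ _))

lastOr-∷ʳ : (u : Vec Bool n) (b : Bool) → lastOr (u ∷ʳ b) ≡ b
lastOr-∷ʳ [] b = refl
lastOr-∷ʳ (x ∷ []) b = refl
lastOr-∷ʳ (x ∷ y ∷ u) b = lastOr-∷ʳ (y ∷ u) b

lastOr-reverse : (u : Vec Bool n) → lastOr (reverse u) ≡ headOr u
lastOr-reverse [] = refl
lastOr-reverse (y ∷ w) rewrite reverse-∷ y w = lastOr-∷ʳ (reverse w) y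

noConsec-reverse : (u : Vec Bool n) → noConsec (reverse u) ≡ noConsec u
noConsec-reverse [] = refl
noConsec-reverse (x ∷ u) rewrite reverse-∷ x u = begin
  noConsec (reverse u ∷ʳ x)                            ≡⟨ noConsec-∷ʳ (reverse u) x ⟩
  noConsec (reverse u) ∧ not (lastOr (reverse u) ∧ x)  ≡⟨ cong₂ (λ a b → a ∧ not (b ∧ x))
                                                                (noConsec-reverse u) (lastOr-reverse u) ⟩
  noConsec u ∧ not (headOr u ∧ x)                      ≡⟨ ∧-comm (noConsec u) _ ⟩
  not (headOr u ∧ x) ∧ noConsec u                      ≡⟨ cong (λ a → not a ∧ noConsec u) (∧-comm (headOr u) x) ⟩
  not (x ∧ headOr u) ∧ noConsec u                      ≡⟨ sym (noConsec-∷ x u) ⟩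
  noConsec (x ∷ u)                                     ∎
  where open ≡-Reasoning

valid-false∷ : (u : Vec Bool n) → Valid u → Valid (false ∷ u)
valid-false∷ u = subst T (sym (noConsec-false∷ u))

valid-false∷⁻ : (u : Vec Bool n) → Valid (false ∷ u) → Valid u
valid-false∷⁻ u = subst T (noConsec-false∷ u)

valid-clear : (w : Vec Bool n) (i : Fin n) → lookup w i ≡ false → Valid (toggle w i) → Valid w
valid-clear (false ∷ []) zero refl _ = tt
valid-clear (false ∷ c ∷ w) zero refl t = proj₂ (Equivalence.to T-∧ t)
valid-clear (true ∷ false ∷ w) (suc zero) refl ()
valid-clear (false ∷ false ∷ w) (suc zero) refl t = valid-clear (false ∷ w) zero refl t
valid-clear (b ∷ c ∷ w) (suc (suc i)) e t =
  let (p , q) = Equivalence.to T-∧ t in Equivalence.from T-∧ (p , valid-clear (c ∷ w) (suc i) e q)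

zeros : ∀ n → Vec Bool n
zeros n = replicate n false

zeros-valid : ∀ n → Valid (zeros n)
zeros-valid zero = tt
zeros-valid (suc zero) = tt
zeros-valid (suc (suc n)) = zeros-valid (suc n)

unit-valid : ∀ n (i : Fin n) → Valid (toggle (zeros n) i)
unit-valid (suc zero) zero = tt
unit-valid (suc (suc n)) zero = zeros-valid (suc n)
unit-valid (suc n) (suc i) = valid-false∷ (toggle (zeros n) i) (unit-valid n i)

blocked : (v : Vec Bool (suc (suc m))) → Valid v → v ≢ zeros _ →
          Σ (Fin (suc (suc m))) λ j → ¬ Valid (toggle v j)
blocked (true ∷ true ∷ w) () v≢0
blocked (true ∷ false ∷ w) _ v≢0 = suc zero , λ ()
blocked (false ∷ true ∷ w) _ v≢0 = zero , λ ()
blocked {zero} (false ∷ false ∷ []) _ v≢0 = ⊥-elim (v≢0 refl)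
blocked {suc m} (false ∷ false ∷ w) t v≢0 with blocked (false ∷ w) t (λ e → v≢0 (cong (false ∷_) e))
... | j , ¬valid = suc j , λ t′ → ¬valid (valid-false∷⁻ (toggle (false ∷ w) j) t′)

Consec : Fin n → Fin n → Set
Consec i j = suc (toℕ i) ≡ toℕ j ⊎ suc (toℕ j) ≡ toℕ i

consec-suc : {i j : Fin n} → Consec (suc i) (suc j) → Consec i j
consec-suc (inj₁ e) = inj₁ (suc-injective e)
consec-suc (inj₂ e) = inj₂ (suc-injective e)

consec? : (i j : Fin n) → Dec (Consec i j)
consec? i j with suc (toℕ i) ℕ.≟ toℕ j | suc (toℕ j) ℕ.≟ toℕ i
... | yes e | _ = yes (inj₁ e)
... | no _ | yes e = yes (inj₂ e)
... | no ¬e₁ | no ¬e₂ = no λ { (inj₁ e) → ¬e₁ e ; (inj₂ e) → ¬e₂ e }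

consec-irrefl : (i : Fin n) → ¬ Consec i i
consec-irrefl i (inj₁ e) = 1+n≢n e
consec-irrefl i (inj₂ e) = 1+n≢n e

pair-valid⇒nonConsec : (i j : Fin n) → Valid (toggle (toggle (zeros n) i) j) → ¬ Consec i j
pair-valid⇒nonConsec zero zero t (inj₁ ())
pair-valid⇒nonConsec zero zero t (inj₂ ())
pair-valid⇒nonConsec zero (suc zero) () c
pair-valid⇒nonConsec zero (suc (suc j)) t (inj₁ ())
pair-valid⇒nonConsec zero (suc (suc j)) t (inj₂ ())
pair-valid⇒nonConsec (suc zero) zero () c
pair-valid⇒nonConsec (suc (suc i)) zero t (inj₁ ())
pair-valid⇒nonConsec (suc (suc i)) zero t (inj₂ ())
pair-valid⇒nonConsec {suc n} (suc i) (suc j) t c =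
  pair-valid⇒nonConsec i j (valid-false∷⁻ (toggle (toggle (zeros n) i) j) t) (consec-suc c)

nonConsec⇒pair-valid : (i j : Fin n) → i ≢ j → ¬ Consec i j → Valid (toggle (toggle (zeros n) i) j)
nonConsec⇒pair-valid zero zero i≢j _ = ⊥-elim (i≢j refl)
nonConsec⇒pair-valid zero (suc zero) _ ¬c = ⊥-elim (¬c (inj₁ refl))
nonConsec⇒pair-valid {suc (suc n)} zero (suc (suc j)) _ _ = unit-valid (suc n) (suc j)
nonConsec⇒pair-valid (suc zero) zero _ ¬c = ⊥-elim (¬c (inj₂ refl))
nonConsec⇒pair-valid {suc (suc n)} (suc (suc i)) zero _ _ = unit-valid (suc n) (suc i)
nonConsec⇒pair-valid {suc n} (suc i) (suc j) i≢j ¬c =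
  valid-false∷ (toggle (toggle (zeros n) i) j)
    (nonConsec⇒pair-valid i j (λ e → i≢j (cong suc e)) (λ c → ¬c (Sum.map (cong suc) (cong suc) c)))

t≢2+t : (t : ℕ) → t ≢ suc (suc t)
t≢2+t zero ()
t≢2+t (suc t) e = t≢2+t t (suc-injective e)

word : ΓV n → Vec Bool n
word = proj₁

vertex-≡ : {x y : ΓV n} → word x ≡ word y → x ≡ y
vertex-≡ {x = u , p} {y = .u , q} refl = cong (u ,_) (T-irrelevant p q)

zeroV : ∀ n → ΓV n
zeroV n = zeros n , zeros-valid n

unitV : ∀ n → Fin n → ΓV n
unitV n i = toggle (zeros n) i , unit-valid n i

reverseV : ΓV n → ΓV n
reverseV (u , p) = reverse u , subst T (sym (noConsec-reverse u)) p

reverseV-involutive : (x : ΓV n) → reverseV (reverseV x) ≡ x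
reverseV-involutive x = vertex-≡ (reverse-involutive (word x))

reverseAut : Aut (ΓV n) (ΓAdj n)
reverseAut = record
  { bij = mk↔ₛ′ reverseV reverseV reverseV-involutive reverseV-involutive
  ; preserve = λ x y → mk⇔ (trans (hamming-reverse (word x) (word y)))
                           (trans (sym (hamming-reverse (word x) (word y))))
  }

module _ {n : ℕ} (g : Aut (ΓV n) (ΓAdj n)) where

  app-word-injective : {x y : ΓV n} → word (app g x) ≡ word (app g y) → word x ≡ word y
  app-word-injective e = cong word (app-injective g (vertex-≡ e))

  unit-image-adj : (k : Fin n) → hamming (word (app g (zeroV n))) (word (app g (unitV n k))) ≡ 1
  unit-image-adj k = app-adj g (hamming-toggle (zeros n) k)

-- For n ≥ 2 every automorphism fixes the zero word: it is the only vertex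
-- of degree n, since every other Fibonacci string has a bit that cannot
-- be set.  (The n neighbours g(e_k) of g(0) would avoid that bit.)
zero-fixed : ∀ m (g : Aut (ΓV (suc (suc m))) (ΓAdj (suc (suc m)))) →
             word (app g (zeroV _)) ≡ zeros _
zero-fixed m g with ≡-dec Bool._≟_ (word (app g (zeroV _))) (zeros _)
... | yes y≡0 = y≡0
... | no y≢0 = ⊥-elim (1+n≰n (injective⇒≤ {f = avoid} avoid-injective))
  where
  N : ℕ
  N = suc (suc m)
  y : Vec Bool N
  y = word (app g (zeroV N))
  j : Fin N
  j = proj₁ (blocked y (proj₂ (app g (zeroV N))) y≢0)
  ¬valid : ¬ Valid (toggle y j)
  ¬valid = proj₂ (blocked y (proj₂ (app g (zeroV N))) y≢0)
  position : Fin N → Fin N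
  position k = proj₁ (hamming≡1 y _ (unit-image-adj g k))
  position-spec : ∀ k → word (app g (unitV N k)) ≡ toggle y (position k)
  position-spec k = proj₂ (hamming≡1 y _ (unit-image-adj g k))
  j≢position : ∀ k → j ≢ position k
  j≢position k j≡p = ¬valid (subst (Valid ∘ toggle y) (sym j≡p)
                              (subst Valid (position-spec k) (proj₂ (app g (unitV N k)))))
  avoid : Fin N → Fin (suc m)
  avoid k = punchOut (j≢position k)
  avoid-injective : ∀ {k k′} → avoid k ≡ avoid k′ → k ≡ k′
  avoid-injective {k} {k′} e = toggle-injective (zeros N) k k′ (app-word-injective g (begin
    word (app g (unitV N k))   ≡⟨ position-spec k ⟩
    toggle y (position k)      ≡⟨ cong (toggle y) (punchOut-injective (j≢position k) (j≢position k′) e) ⟩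
    toggle y (position k′)     ≡⟨ sym (position-spec k′) ⟩
    word (app g (unitV N k′))  ∎))
    where open ≡-Reasoning

module UnitImages {n : ℕ} (g : Aut (ΓV n) (ΓAdj n)) (g0 : word (app g (zeroV n)) ≡ zeros n) where

  private
    unit-adj : ∀ k → hamming (zeros n) (word (app g (unitV n k))) ≡ 1
    unit-adj k = subst (λ w → hamming w (word (app g (unitV n k))) ≡ 1) g0 (unit-image-adj g k)

  π : Fin n → Fin n
  π k = proj₁ (hamming≡1 (zeros n) _ (unit-adj k))

  π-spec : ∀ k → word (app g (unitV n k)) ≡ toggle (zeros n) (π k)
  π-spec k = proj₂ (hamming≡1 (zeros n) _ (unit-adj k))

  π-injective : ∀ {i j} → π i ≡ π j → i ≡ j
  π-injective {i} {j} e = toggle-injective (zeros n) i j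
    (app-word-injective g (trans (π-spec i) (trans (cong (toggle (zeros n)) e) (sym (π-spec j)))))

  -- g(e_i + e_j) is a common neighbour of e_(π i) and e_(π j) other than
  -- g(0) = 0, hence equals e_(π i) + e_(π j), which must be valid.
  π-nonConsec : ∀ {i j} → i ≢ j → ¬ Consec i j → ¬ Consec (π i) (π j)
  π-nonConsec {i} {j} i≢j ¬c = conclude (common-neighbours eπi x (π i) (π j) πi≢πj adjᵢ adjⱼ)
    where
    z x eπi : Vec Bool n
    z = zeros n
    w : ΓV n
    w = toggle (toggle z i) j , nonConsec⇒pair-valid i j i≢j ¬c
    x = word (app g w)
    eπi = toggle z (π i)
    πi≢πj : π i ≢ π j
    πi≢πj e = i≢j (π-injective e)
    adjᵢ : hamming eπi x ≡ 1
    adjᵢ = subst (λ v → hamming v x ≡ 1) (π-spec i) (app-adj g (hamming-toggle (toggle z i) j))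
    adjⱼ : hamming (toggle (toggle eπi (π i)) (π j)) x ≡ 1
    adjⱼ = subst (λ v → hamming (toggle v (π j)) x ≡ 1) (sym (toggle-involutive z (π i)))
             (subst (λ v → hamming v x ≡ 1) (π-spec j)
               (app-adj g (subst (λ v → hamming (toggle z j) v ≡ 1) (toggle-comm z j i)
                                 (hamming-toggle (toggle z j) i))))
    open ≡-Reasoning
    conclude : x ≡ toggle eπi (π i) ⊎ x ≡ toggle eπi (π j) → ¬ Consec (π i) (π j)
    conclude (inj₂ x≡pair) = pair-valid⇒nonConsec (π i) (π j) (subst Valid x≡pair (proj₂ (app g w)))
    conclude (inj₁ x≡0) = ⊥-elim (i≢j (toggle-injective z i j (begin
      toggle z i                        ≡⟨ sym (toggle-involutive (toggle z i) j) ⟩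
      toggle (toggle (toggle z i) j) j  ≡⟨ cong (λ v → toggle v j) w≡0 ⟩
      toggle z j                        ∎)))
      where
      w≡0 : toggle (toggle z i) j ≡ z
      w≡0 = app-word-injective g (trans x≡0 (trans (toggle-involutive z (π i)) (sym g0)))

module PathAutomorphism {m : ℕ} (π π⁻ : Fin (suc (suc m)) → Fin (suc (suc m)))
  (π∘π⁻ : ∀ k → π (π⁻ k) ≡ k) (π⁻∘π : ∀ k → π⁻ (π k) ≡ k)
  (π-consec : ∀ {i j} → Consec i j → Consec (π i) (π j))
  (π⁻-consec : ∀ {i j} → Consec i j → Consec (π⁻ i) (π⁻ j)) where

  private
    N : ℕ
    N = suc (suc m)

    π-injective : ∀ {i j} → π i ≡ π j → i ≡ j
    π-injective {i} {j} e = trans (sym (π⁻∘π i)) (trans (cong π⁻ e) (π⁻∘π j))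

    π⁻-injective : ∀ {i j} → π⁻ i ≡ π⁻ j → i ≡ j
    π⁻-injective {i} {j} e = trans (sym (π∘π⁻ i)) (trans (cong π e) (π∘π⁻ j))

    consec-zero : ∀ {x : Fin N} → Consec x zero → toℕ x ≡ 1
    consec-zero (inj₂ e) = sym e

    position : ∀ t → t < N → Σ (Fin N) λ a → toℕ a ≡ t
    position t t<N = fromℕ< t<N , toℕ-fromℕ< t<N

  -- An inner position t+1 has two neighbours t and t+2; their preimages
  -- would both be neighbours of 0, i.e. both equal to position 1.
  π-endpoint : π zero ≡ zero ⊎ π zero ≡ fromℕ (suc m)
  π-endpoint with toℕ (π zero) in e
  ... | zero = inj₁ (toℕ-injective e)
  ... | suc t with m≤n⇒m<n∨m≡n (s≤s⁻¹ (subst (_< N) e (toℕ<n (π zero))))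
  ...   | inj₂ t+1≡last = inj₂ (toℕ-injective (trans e (trans t+1≡last (sym (toℕ-fromℕ (suc m))))))
  ...   | inj₁ t+2≤last = ⊥-elim (t≢2+t t (trans (sym ea) (trans (cong toℕ (π⁻-injective a≡b)) eb)))
    where
    t+2<N : suc (suc t) < N
    t+2<N = s≤s t+2≤last
    a b : Fin N
    a = proj₁ (position t (<-trans (n<1+n t) (<-trans (n<1+n (suc t)) t+2<N)))
    b = proj₁ (position (suc (suc t)) t+2<N)
    ea : toℕ a ≡ t
    ea = proj₂ (position t (<-trans (n<1+n t) (<-trans (n<1+n (suc t)) t+2<N)))
    eb : toℕ b ≡ suc (suc t)
    eb = proj₂ (position (suc (suc t)) t+2<N)
    preimage-one : ∀ x → Consec x (π zero) → toℕ (π⁻ x) ≡ 1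
    preimage-one x c = consec-zero (subst (Consec (π⁻ x)) (π⁻∘π zero) (π⁻-consec c))
    a≡b : π⁻ a ≡ π⁻ b
    a≡b = toℕ-injective (trans (preimage-one a (inj₁ (trans (cong suc ea) (sym e))))
                               (sym (preimage-one b (inj₂ (trans (cong suc e) (sym eb))))))

  -- Fixing 0 forces fixing 1, and fixing t and t+1 forces fixing t+2.
  π-rigid : π zero ≡ zero → ∀ i → π i ≡ i
  π-rigid π0 i = toℕ-injective (proj₁ (fixed-upto (toℕ i)) i refl)
    where
    FixedAt : ℕ → Set
    FixedAt t = ∀ i → toℕ i ≡ t → toℕ (π i) ≡ t
    fixed-upto : ∀ t → FixedAt t × FixedAt (suc t)
    fixed-upto zero = fixed0 , fixed1
      where
      fixed0 : FixedAt 0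
      fixed0 zero _ = cong toℕ π0
      fixed1 : FixedAt 1
      fixed1 i e = consec-zero (subst (Consec (π i)) π0 (π-consec (inj₂ (sym e))))
    fixed-upto (suc t) = proj₂ (fixed-upto t) , fixed2
      where
      fixed2 : FixedAt (suc (suc t))
      fixed2 i e = conclude (π-consec (inj₁ (trans (cong suc ej) (sym e))))
        where
        t+1<N : suc t < N
        t+1<N = <-trans (n<1+n (suc t)) (subst (_< N) e (toℕ<n i))
        j l : Fin N
        j = proj₁ (position (suc t) t+1<N)
        l = proj₁ (position t (<-trans (n<1+n t) t+1<N))
        ej : toℕ j ≡ suc t
        ej = proj₂ (position (suc t) t+1<N)
        el : toℕ l ≡ t
        el = proj₂ (position t (<-trans (n<1+n t) t+1<N))
        πj : toℕ (π j) ≡ suc t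
        πj = proj₂ (fixed-upto t) j ej
        πl : toℕ (π l) ≡ t
        πl = proj₁ (fixed-upto t) l el
        conclude : Consec (π j) (π i) → toℕ (π i) ≡ suc (suc t)
        conclude (inj₁ c) = trans (sym c) (cong suc πj)
        conclude (inj₂ c) = ⊥-elim (t≢2+t t (trans (sym el) (trans (cong toℕ l≡i) e)))
          where
          l≡i : l ≡ i
          l≡i = π-injective (toℕ-injective (trans πl (sym (suc-injective (trans c πj)))))

weight : Vec Bool n → ℕ
weight {n} v = hamming (zeros n) v

peel : ∀ k (v : Vec Bool n) → weight v ≡ suc k →
       Σ (Vec Bool n) λ c → Σ (Fin n) λ i → v ≡ toggle c i × lookup c i ≡ false × weight c ≡ k
peel k (true ∷ v) e = false ∷ v , zero , refl , refl , suc-injective e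
peel k (false ∷ v) e =
  let (c , i , v≡ , ci , wc) = peel k v e in false ∷ c , suc i , cong (false ∷_) v≡ , ci , wc

record TwoBits {n : ℕ} (v : Vec Bool n) (k : ℕ) : Set where
  field
    c : Vec Bool n
    i j : Fin n
    v≡ : v ≡ toggle (toggle c j) i
    j≢i : j ≢ i
    cᵢ : lookup c i ≡ false
    cⱼ : lookup c j ≡ false
    wc : weight c ≡ k

peel₂ : ∀ k (v : Vec Bool n) → weight v ≡ suc (suc k) → TwoBits v k
peel₂ k v e with peel (suc k) v e
... | c₁ , i , v≡ , c₁ᵢ , wc₁ with peel k c₁ wc₁
...   | c , j , refl , cⱼ , wc = record
  { c = c ; i = i ; j = j ; v≡ = v≡ ; j≢i = j≢i ; cⱼ = cⱼ ; wc = wc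
  ; cᵢ = trans (sym (lookup-toggle-other c j≢i)) c₁ᵢ }
  where
  j≢i : j ≢ i
  j≢i j≡i = false≢true (begin
    false                       ≡⟨ sym c₁ᵢ ⟩
    lookup (toggle c j) i       ≡⟨ cong (lookup (toggle c j)) (sym j≡i) ⟩
    lookup (toggle c j) j       ≡⟨ lookup-toggle c j ⟩
    not (lookup c j)            ≡⟨ cong not cⱼ ⟩
    true                        ∎)
    where open ≡-Reasoning

weight-toggle : (c : Vec Bool n) (i : Fin n) → lookup c i ≡ false → weight (toggle c i) ≡ suc (weight c)
weight-toggle (false ∷ c) zero refl = refl
weight-toggle (true ∷ c) (suc i) e = cong suc (weight-toggle c i e)
weight-toggle (false ∷ c) (suc i) e = weight-toggle c i e

-- An automorphism fixing zero and every unit word is the identity: by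
-- induction on the weight, a vertex x of weight k+2 is the unique common
-- neighbour, besides a vertex of weight k, of two fixed vertices of weight k+1.
module FixedUnits {n : ℕ} (g : Aut (ΓV n) (ΓAdj n)) (g0 : word (app g (zeroV n)) ≡ zeros n)
                  (g-units : ∀ i → word (app g (unitV n i)) ≡ toggle (zeros n) i) where

  FixedAt : ℕ → Set
  FixedAt k = ∀ x → weight (word x) ≡ k → word (app g x) ≡ word x

  fixed0 : FixedAt 0
  fixed0 x e = trans (cong (λ v → word (app g v)) x≡0) (trans g0 (sym (cong word x≡0)))
    where
    x≡0 : x ≡ zeroV n
    x≡0 = vertex-≡ (sym (hamming≡0 _ _ e))

  fixed1 : FixedAt 1
  fixed1 x e with peel 0 (word x) e
  ... | c , i , x≡ , _ , wc =
    trans (cong (λ v → word (app g v)) x≡eᵢ) (trans (g-units i) (sym (cong word x≡eᵢ)))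
    where
    x≡eᵢ : x ≡ unitV n i
    x≡eᵢ = vertex-≡ (trans x≡ (cong (λ v → toggle v i) (sym (hamming≡0 _ _ wc))))

  fixed-step : ∀ k → FixedAt k → FixedAt (suc k) → FixedAt (suc (suc k))
  fixed-step k fixedₖ fixedₖ₊₁ x e = conclude (common-neighbours a y j i j≢i adj-a adj-b)
    where
    open TwoBits (peel₂ k (word x) e)
    i≢j : i ≢ j
    i≢j i≡j = j≢i (sym i≡j)
    x≡′ : word x ≡ toggle (toggle c i) j
    x≡′ = trans v≡ (toggle-comm c j i)
    -- x = c + e_i + e_j lies above a = c + e_j and b = c + e_i, which lie above c
    a b : Vec Bool n
    a = toggle c j
    b = toggle c i
    aV bV cV : ΓV n
    aV = a , valid-clear a i (trans (lookup-toggle-other c j≢i) cᵢ) (subst Valid v≡ (proj₂ x))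
    bV = b , valid-clear b j (trans (lookup-toggle-other c i≢j) cⱼ) (subst Valid x≡′ (proj₂ x))
    cV = c , valid-clear c j cⱼ (proj₂ aV)
    y : Vec Bool n
    y = word (app g x)
    adj-a : hamming a y ≡ 1
    adj-a = subst (λ v → hamming v y ≡ 1) (fixedₖ₊₁ aV (trans (weight-toggle c j cⱼ) (cong suc wc)))
              (app-adj g (subst (λ v → hamming a v ≡ 1) (sym v≡) (hamming-toggle a i)))
    adj-b : hamming (toggle (toggle a j) i) y ≡ 1
    adj-b = subst (λ v → hamming (toggle v i) y ≡ 1) (sym (toggle-involutive c j))
              (subst (λ v → hamming v y ≡ 1) (fixedₖ₊₁ bV (trans (weight-toggle c i cᵢ) (cong suc wc)))
                (app-adj g (subst (λ v → hamming b v ≡ 1) (sym x≡′) (hamming-toggle b j))))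
    conclude : y ≡ toggle a j ⊎ y ≡ toggle a i → y ≡ word x
    conclude (inj₂ y≡x) = trans y≡x (sym v≡)
    conclude (inj₁ y≡c) = ⊥-elim (t≢2+t k (trans (sym wc) (trans (cong weight (sym v≡c)) e)))
      where
      v≡c : word x ≡ c
      v≡c = app-word-injective g (trans y≡c (trans (toggle-involutive c j) (sym (fixedₖ cV wc))))

  fixed-upto : ∀ k → FixedAt k × FixedAt (suc k)
  fixed-upto zero = fixed0 , fixed1
  fixed-upto (suc k) = proj₂ (fixed-upto k) , fixed-step k (proj₁ (fixed-upto k)) (proj₂ (fixed-upto k))

  fixes-all : ∀ x → word (app g x) ≡ word x
  fixes-all x = proj₁ (fixed-upto (weight (word x))) x refl

consec-transfer : (σ τ : Fin n → Fin n) → (∀ k → τ (σ k) ≡ k) →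
                  (∀ {i j} → i ≢ j → ¬ Consec i j → ¬ Consec (τ i) (τ j)) →
                  ∀ {i j} → Consec i j → Consec (σ i) (σ j)
consec-transfer σ τ τ∘σ τ-sep {i} {j} c with consec? (σ i) (σ j)
... | yes c′ = c′
... | no ¬c′ with σ i Fin.≟ σ j
...   | yes e = ⊥-elim (consec-irrefl j (subst (λ k → Consec k j) i≡j c))
  where
  i≡j : i ≡ j
  i≡j = trans (sym (τ∘σ i)) (trans (cong τ e) (τ∘σ j))
...   | no σi≢σj = ⊥-elim (τ-sep σi≢σj ¬c′ (subst₂ Consec (sym (τ∘σ i)) (sym (τ∘σ j)) c))

module UnitPermutation (m : ℕ) (g : Aut (ΓV (suc (suc m))) (ΓAdj (suc (suc m)))) where

  private
    N : ℕ
    N = suc (suc m)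
    z : Vec Bool N
    z = zeros N

    g0 : word (app g (zeroV N)) ≡ z
    g0 = zero-fixed m g

    g⁻¹0 : word (app (inverseAut g) (zeroV N)) ≡ z
    g⁻¹0 = cong word (trans (cong (app (inverseAut g)) (sym (vertex-≡ g0))) (app-inverseʳ g (zeroV N)))

    module U = UnitImages g g0
    module U⁻ = UnitImages (inverseAut g) g⁻¹0

    π∘π⁻ : ∀ k → U.π (U⁻.π k) ≡ k
    π∘π⁻ k = toggle-injective z _ _ (begin
      toggle z (U.π (U⁻.π k))                        ≡⟨ sym (U.π-spec (U⁻.π k)) ⟩
      word (app g (unitV N (U⁻.π k)))                ≡⟨ cong (word ∘ app g) (vertex-≡ (sym (U⁻.π-spec k))) ⟩
      word (app g (app (inverseAut g) (unitV N k)))  ≡⟨ cong word (app-inverseˡ g (unitV N k)) ⟩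
      toggle z k                                     ∎)
      where open ≡-Reasoning

    π⁻∘π : ∀ k → U⁻.π (U.π k) ≡ k
    π⁻∘π k = toggle-injective z _ _ (begin
      toggle z (U⁻.π (U.π k))                        ≡⟨ sym (U⁻.π-spec (U.π k)) ⟩
      word (app (inverseAut g) (unitV N (U.π k)))    ≡⟨ cong (word ∘ app (inverseAut g)) (vertex-≡ (sym (U.π-spec k))) ⟩
      word (app (inverseAut g) (app g (unitV N k)))  ≡⟨ cong word (app-inverseʳ g (unitV N k)) ⟩
      toggle z k                                     ∎)
      where open ≡-Reasoning

    open PathAutomorphism U.π U⁻.π π∘π⁻ π⁻∘π
      (consec-transfer U.π U⁻.π π⁻∘π U⁻.π-nonConsec) (consec-transfer U⁻.π U.π π∘π⁻ U.π-nonConsec)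

  first-unit : word (app g (unitV N zero)) ≡ toggle z zero
             ⊎ word (app g (unitV N zero)) ≡ toggle z (fromℕ (suc m))
  first-unit with π-endpoint
  ... | inj₁ e = inj₁ (trans (U.π-spec zero) (cong (toggle z) e))
  ... | inj₂ e = inj₂ (trans (U.π-spec zero) (cong (toggle z) e))

  identity-if-first-unit-fixed : word (app g (unitV N zero)) ≡ toggle z zero → ∀ x → word (app g x) ≡ word x
  identity-if-first-unit-fixed e = FixedUnits.fixes-all g g0 g-units
    where
    π0 : U.π zero ≡ zero
    π0 = toggle-injective z _ _ (trans (sym (U.π-spec zero)) e)
    g-units : ∀ i → word (app g (unitV N i)) ≡ toggle z i
    g-units i = trans (U.π-spec i) (cong (toggle z) (π-rigid π0 i))

reverse-zeros : ∀ n → reverse (zeros n) ≡ zeros n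
reverse-zeros zero = refl
reverse-zeros (suc n) rewrite reverse-∷ false (zeros n) = trans (cong (_∷ʳ false) (reverse-zeros n)) (zeros-∷ʳ n)
  where
  zeros-∷ʳ : ∀ n → zeros n ∷ʳ false ≡ zeros (suc n)
  zeros-∷ʳ zero = refl
  zeros-∷ʳ (suc n) = cong (false ∷_) (zeros-∷ʳ n)

classification : ∀ m (g : Aut (ΓV (suc (suc m))) (ΓAdj (suc (suc m)))) →
                 (∀ x → word (app g x) ≡ word x) ⊎ (∀ x → word (app g x) ≡ reverse (word x))
classification m g with UnitPermutation.first-unit m g
... | inj₁ e = inj₁ (UnitPermutation.identity-if-first-unit-fixed m g e)
... | inj₂ e = inj₂ λ x → begin
    word (app g x)                    ≡⟨ sym (reverse-involutive _) ⟩
    reverse (word (app h x))          ≡⟨ cong reverse (UnitPermutation.identity-if-first-unit-fixed m h h-e₀ x) ⟩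
    reverse (word x)                  ∎
  where
  open ≡-Reasoning
  N : ℕ
  N = suc (suc m)
  h : Aut (ΓV N) (ΓAdj N)
  h = composeAut reverseAut g
  h-e₀ : word (app h (unitV N zero)) ≡ toggle (zeros N) zero
  h-e₀ = begin
    reverse (word (app g (unitV N zero)))          ≡⟨ cong reverse e ⟩
    reverse (toggle (zeros N) (fromℕ (suc m)))     ≡⟨ sym (toggle-reverse (zeros N) (fromℕ (suc m))) ⟩
    toggle (reverse (zeros N)) (opposite (fromℕ (suc m)))
                                                   ≡⟨ cong₂ toggle (reverse-zeros N) (Fin.opposite-involutive zero) ⟩
    toggle (zeros N) zero                          ∎

-- Every edge of Γ_n is {u , u + e_i} for exactly one Fibonacci string u
-- with u_i = 0 whose i-th bit can be set: the code of the edge.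
record Code (n : ℕ) : Set where
  constructor code
  field
    low        : Vec Bool n
    bit        : Fin n
    low-valid  : Valid low
    bit-clear  : lookup low bit ≡ false
    high-valid : Valid (toggle low bit)

open Code

-- a code is determined by its word and its bit (the rest is proof-irrelevant)
code-≡ : {c d : Code n} → low c ≡ low d → bit c ≡ bit d → c ≡ d
code-≡ {c = code u i p e q} {code .u .i p′ e′ q′} refl refl
  rewrite T-irrelevant p p′ | ≡-irrelevant e e′ | T-irrelevant q q′ = refl

_≟ᶜ_ : DecidableEquality (Code n)
c ≟ᶜ d with ≡-dec Bool._≟_ (low c) (low d) | bit c Fin.≟ bit d
... | yes e₁ | yes e₂ = yes (code-≡ e₁ e₂)
... | no ¬e | _ = no λ e → ¬e (cong low e)
... | _ | no ¬e = no λ e → ¬e (cong bit e)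

lowV highV : Code n → ΓV n
lowV c = low c , low-valid c
highV c = toggle (low c) (bit c) , high-valid c

edgeOf : Code n → Edge (ΓV n) (ΓAdj n)
edgeOf c = (lowV c , highV c) , hamming-toggle (low c) (bit c)

reverseCode : Code n → Code n
reverseCode (code u i p e q) = code (reverse u) (opposite i)
  (subst T (sym (noConsec-reverse u)) p)
  (trans (lookup-reverse u i) e)
  (subst T (sym (trans (cong noConsec (toggle-reverse u i)) (noConsec-reverse (toggle u i)))) q)

reverseCode-involutive : (c : Code n) → reverseCode (reverseCode c) ≡ c
reverseCode-involutive c = code-≡ (reverse-involutive (low c)) (Fin.opposite-involutive (bit c))

reverse-edgeOf : (c : Code n) → SameEdge (act reverseAut (edgeOf c)) (edgeOf (reverseCode c))
reverse-edgeOf c = inj₁ (refl , vertex-≡ (sym (toggle-reverse (low c) (bit c))))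

edge-code : (x : Edge (ΓV n) (ΓAdj n)) → Σ (Code n) λ c → SameEdge x (edgeOf c)
edge-code (((u , p) , (v , q)) , h) with hamming≡1 u v h
... | i , refl with lookup u i in eq
...   | false = code u i p eq q , inj₁ (refl , refl)
...   | true = code (toggle u i) i q u-clear (subst Valid (sym (toggle-involutive u i)) p) ,
               inj₂ (vertex-≡ (sym (toggle-involutive u i)) , refl)
  where
  u-clear : lookup (toggle u i) i ≡ false
  u-clear = trans (lookup-toggle u i) (cong not eq)

edgeOf-injective : (c d : Code n) → SameEdge (edgeOf c) (edgeOf d) → c ≡ d
edgeOf-injective c d (inj₁ (lows , highs)) =
  code-≡ low≡ (toggle-injective (low c) _ _ (trans (cong word highs) (cong (λ w → toggle w (bit d)) (sym low≡))))
  where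
  low≡ : low c ≡ low d
  low≡ = cong word lows
edgeOf-injective {n} c d (inj₂ (lows , highs)) = ⊥-elim (false≢true (begin
    false                        ≡⟨ sym (bit-clear d) ⟩
    lookup (low d) (bit d)       ≡⟨ cong₂ lookup (sym high≡low) j≡i ⟩
    lookup (toggle u i) i        ≡⟨ lookup-toggle u i ⟩
    not (lookup u i)             ≡⟨ cong not (bit-clear c) ⟩
    true                         ∎))
  where
  open ≡-Reasoning
  u : Vec Bool n
  u = low c
  i : Fin n
  i = bit c
  high≡low : toggle u i ≡ low d
  high≡low = cong word highs
  j≡i : bit d ≡ i
  j≡i = toggle-injective u (bit d) i (begin
    toggle u (bit d)                             ≡⟨ cong (λ w → toggle w (bit d)) (cong word lows) ⟩
    toggle (toggle (low d) (bit d)) (bit d)      ≡⟨ toggle-involutive (low d) (bit d) ⟩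
    low d                                        ≡⟨ sym high≡low ⟩
    toggle u i                                   ∎)

orbit-partner : (c : Code n) → SameOrbit (edgeOf c) (edgeOf (reverseCode c))
orbit-partner c = reverseAut , reverse-edgeOf c

code₁-unique : (c d : Code 1) → c ≡ d
code₁-unique (code (false ∷ []) zero _ refl _) (code (false ∷ []) zero _ refl _) = code-≡ refl refl

agree-on-edge : (g h : Aut (ΓV n) (ΓAdj n)) → (∀ x → word (app g x) ≡ word (app h x)) →
                (c : Code n) → SameEdge (act g (edgeOf c)) (act h (edgeOf c))
agree-on-edge g h g≗h c = inj₁ (vertex-≡ (g≗h (lowV c)) , vertex-≡ (g≗h (highV c)))

-- the converse, from the classification of automorphisms (n ≥ 2) and by
-- inspection for n ≤ 1
orbit-sound : (c d : Code n) → SameOrbit (edgeOf c) (edgeOf d) → d ≡ c ⊎ d ≡ reverseCode c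
orbit-sound {zero} (code _ () _ _ _) _ _
orbit-sound {suc zero} c d _ = inj₁ (code₁-unique d c)
orbit-sound {suc (suc m)} c d (g , s) with classification m g
... | inj₁ g≡id = inj₁ (sym (edgeOf-injective c d
        (sameEdge-trans (edgeOf c) (act g (edgeOf c)) (edgeOf d)
          (agree-on-edge identityAut g (λ x → sym (g≡id x)) c) s)))
  where open EdgeFacts (ΓV (suc (suc m))) (ΓAdj (suc (suc m)))
... | inj₂ g≡rev = inj₂ (sym (edgeOf-injective (reverseCode c) d
        (sameEdge-trans (edgeOf (reverseCode c)) (act g (edgeOf c)) (edgeOf d)
          (sameEdge-trans (edgeOf (reverseCode c)) (act reverseAut (edgeOf c)) (act g (edgeOf c))
            (sameEdge-sym (act reverseAut (edgeOf c)) (edgeOf (reverseCode c)) (reverse-edgeOf c))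
            (agree-on-edge reverseAut g (λ x → sym (g≡rev x)) c)) s)))
  where open EdgeFacts (ΓV (suc (suc m))) (ΓAdj (suc (suc m)))


prepend0 : ΓV (suc n) → ΓV (suc (suc n))
prepend0 (u , p) = false ∷ u , valid-false∷ u p

prepend10 : ΓV n → ΓV (suc (suc n))
prepend10 (u , p) = true ∷ false ∷ u , valid-false∷ u p

vertices : ∀ n → List (ΓV n)
vertices zero = ([] , tt) ∷ []
vertices (suc zero) = (false ∷ [] , tt) ∷ (true ∷ [] , tt) ∷ []
vertices (suc (suc n)) = map prepend0 (vertices (suc n)) ++ map prepend10 (vertices n)

vertices-length : ∀ n → length (vertices n) ≡ F (suc (suc n))
vertices-length zero = refl
vertices-length (suc zero) = refl
vertices-length (suc (suc n)) = begin
  length (map prepend0 (vertices (suc n)) ++ map prepend10 (vertices n))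
    ≡⟨ length-++ (map prepend0 (vertices (suc n))) ⟩
  length (map prepend0 (vertices (suc n))) + length (map prepend10 (vertices n))
    ≡⟨ cong₂ _+_ (length-map prepend0 (vertices (suc n))) (length-map prepend10 (vertices n)) ⟩
  length (vertices (suc n)) + length (vertices n)
    ≡⟨ cong₂ _+_ (vertices-length (suc n)) (vertices-length n) ⟩
  F (suc (suc (suc (suc n))))  ∎
  where open ≡-Reasoning

vertices-complete : ∀ n (x : ΓV n) → x ∈ vertices n
vertices-complete zero ([] , tt) = here refl
vertices-complete (suc zero) (false ∷ [] , tt) = here refl
vertices-complete (suc zero) (true ∷ [] , tt) = there (here refl)
vertices-complete (suc (suc n)) (false ∷ u , p) =
  subst (_∈ vertices (suc (suc n))) (vertex-≡ refl)
    (∈-++⁺ˡ (∈-map⁺ prepend0 (vertices-complete (suc n) (u , valid-false∷⁻ u p))))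
vertices-complete (suc (suc n)) (true ∷ true ∷ w , ())
vertices-complete (suc (suc n)) (true ∷ false ∷ w , p) =
  subst (_∈ vertices (suc (suc n))) (vertex-≡ refl)
    (∈-++⁺ʳ (map prepend0 (vertices (suc n)))
      (∈-map⁺ prepend10 (vertices-complete n (w , valid-false∷⁻ w p))))

vertices-unique : ∀ n → Unique (vertices n)
vertices-unique zero = [] ∷ []
vertices-unique (suc zero) = ((λ ()) ∷ []) ∷ [] ∷ []
vertices-unique (suc (suc n)) = Uniqueₚ.++⁺
  (Uniqueₚ.map⁺ (λ e → vertex-≡ (cong (Vec.tail ∘ word) e)) (vertices-unique (suc n)))
  (Uniqueₚ.map⁺ (λ e → vertex-≡ (cong (Vec.tail ∘ Vec.tail ∘ word) e)) (vertices-unique n))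
  (map-disjoint prepend0 prepend10 (λ _ _ e → false≢true (cong (Vec.head ∘ word) e)))

-- The codes of Γ_(n+2): a code of Γ_(n+1) behind a 0, a code of Γ_n
-- behind 10, or a word 00w with the first bit to be set.
shift0 : Code (suc n) → Code (suc (suc n))
shift0 (code u i p e q) = code (false ∷ u) (suc i) (valid-false∷ u p) e (valid-false∷ (toggle u i) q)

shift10 : Code n → Code (suc (suc n))
shift10 (code u i p e q) =
  code (true ∷ false ∷ u) (suc (suc i)) (valid-false∷ u p) e (valid-false∷ (toggle u i) q)

firstBit : ΓV n → Code (suc (suc n))
firstBit (w , p) = code (false ∷ false ∷ w) zero (valid-false∷ w p) refl (valid-false∷ w p)

code₁ : Code 1
code₁ = code (false ∷ []) zero tt refl tt

codes : ∀ n → List (Code n)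
codes zero = []
codes (suc zero) = code₁ ∷ []
codes (suc (suc n)) = map shift0 (codes (suc n)) ++ (map shift10 (codes n) ++ map firstBit (vertices n))

-- |E(Γ_n)|, through the recurrence given by the decomposition of codes
edgeCount : ℕ → ℕ
edgeCount zero = 0
edgeCount (suc zero) = 1
edgeCount (suc (suc n)) = edgeCount (suc n) + (edgeCount n + F (suc (suc n)))

codes-length : ∀ n → length (codes n) ≡ edgeCount n
codes-length zero = refl
codes-length (suc zero) = refl
codes-length (suc (suc n)) = begin
  length (map shift0 (codes (suc n)) ++ (map shift10 (codes n) ++ map firstBit (vertices n)))
    ≡⟨ length-++ (map shift0 (codes (suc n))) ⟩
  length (map shift0 (codes (suc n))) + length (map shift10 (codes n) ++ map firstBit (vertices n))
    ≡⟨ cong (length (map shift0 (codes (suc n))) +_) (length-++ (map shift10 (codes n))) ⟩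
  length (map shift0 (codes (suc n))) + (length (map shift10 (codes n)) + length (map firstBit (vertices n)))
    ≡⟨ cong₂ (λ a b → a + (b + length (map firstBit (vertices n))))
             (length-map shift0 (codes (suc n))) (length-map shift10 (codes n)) ⟩
  length (codes (suc n)) + (length (codes n) + length (map firstBit (vertices n)))
    ≡⟨ cong₂ (λ a b → a + (b + length (map firstBit (vertices n)))) (codes-length (suc n)) (codes-length n) ⟩
  edgeCount (suc n) + (edgeCount n + length (map firstBit (vertices n)))
    ≡⟨ cong (λ k → edgeCount (suc n) + (edgeCount n + k))
            (trans (length-map firstBit (vertices n)) (vertices-length n)) ⟩
  edgeCount (suc (suc n))  ∎
  where open ≡-Reasoning

codes-complete : ∀ n (c : Code n) → c ∈ codes n
codes-complete (suc zero) (code (false ∷ []) zero _ refl _) = here (code-≡ refl refl)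
codes-complete (suc (suc n)) (code (false ∷ u) (suc i) p e q) =
  subst (_∈ codes (suc (suc n))) (code-≡ refl refl)
    (∈-++⁺ˡ (∈-map⁺ shift0
      (codes-complete (suc n) (code u i (valid-false∷⁻ u p) e (valid-false∷⁻ (toggle u i) q)))))
codes-complete (suc (suc n)) (code (true ∷ true ∷ w) i () e q)
codes-complete (suc (suc n)) (code (true ∷ false ∷ w) zero p () q)
codes-complete (suc (suc n)) (code (true ∷ false ∷ w) (suc zero) p e ())
codes-complete (suc (suc n)) (code (true ∷ false ∷ w) (suc (suc i)) p e q) =
  subst (_∈ codes (suc (suc n))) (code-≡ refl refl)
    (∈-++⁺ʳ (map shift0 (codes (suc n))) (∈-++⁺ˡ (∈-map⁺ shift10
      (codes-complete n (code w i (valid-false∷⁻ w p) e (valid-false∷⁻ (toggle w i) q))))))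
codes-complete (suc (suc n)) (code (false ∷ true ∷ w) zero p e ())
codes-complete (suc (suc n)) (code (false ∷ false ∷ w) zero p e q) =
  subst (_∈ codes (suc (suc n))) (code-≡ refl refl)
    (∈-++⁺ʳ (map shift0 (codes (suc n))) (∈-++⁺ʳ (map shift10 (codes n))
      (∈-map⁺ firstBit (vertices-complete n (w , valid-false∷⁻ w p)))))

codes-unique : ∀ n → Unique (codes n)
codes-unique zero = []
codes-unique (suc zero) = [] ∷ []
codes-unique (suc (suc n)) = Uniqueₚ.++⁺
  (Uniqueₚ.map⁺ (λ e → code-≡ (cong (Vec.tail ∘ low) e) (Fin.suc-injective (cong bit e)))
                (codes-unique (suc n)))
  (Uniqueₚ.++⁺
    (Uniqueₚ.map⁺ (λ e → code-≡ (cong (Vec.tail ∘ Vec.tail ∘ low) e)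
                                (Fin.suc-injective (Fin.suc-injective (cong bit e)))) (codes-unique n))
    (Uniqueₚ.map⁺ (λ e → vertex-≡ (cong (Vec.tail ∘ Vec.tail ∘ low) e)) (vertices-unique n))
    (map-disjoint shift10 firstBit (λ _ _ e → false≢true (cong (Vec.head ∘ low) (sym e)))))
  (λ (m , m′) → case (∈-++⁻ (map shift10 (codes n)) m′) m)
  where
  case : ∀ {c} → c ∈ map shift10 (codes n) ⊎ c ∈ map firstBit (vertices n) →
         c ∈ map shift0 (codes (suc n)) → ⊥
  case (inj₁ m′) m = map-disjoint shift0 shift10 (λ _ _ e → false≢true (cong (Vec.head ∘ low) e)) (m , m′)
  case (inj₂ m′) m = map-disjoint shift0 firstBit (λ _ _ e → zero≢suc (cong bit (sym e))) (m , m′)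


-- Palindromic words and self-opposite positions of length n+2 are framed
-- ones: frame b u = b u b, and framePos i is the position of i inside it.
frame : Bool → Vec Bool n → Vec Bool (suc (suc n))
frame b u = b ∷ (u ∷ʳ b)

framePos : Fin n → Fin (suc (suc n))
framePos i = suc (inject₁ i)

reverse-∷-∷ʳ : (b b′ : Bool) (u : Vec Bool n) → reverse (b ∷ (u ∷ʳ b′)) ≡ b′ ∷ (reverse u ∷ʳ b)
reverse-∷-∷ʳ b b′ u rewrite reverse-∷ b (u ∷ʳ b′) = cong (_∷ʳ b) (reverse-∷ʳ u)
  where
  reverse-∷ʳ : ∀ {k} (w : Vec Bool k) → reverse (w ∷ʳ b′) ≡ b′ ∷ reverse w
  reverse-∷ʳ [] = refl
  reverse-∷ʳ (x ∷ w) rewrite reverse-∷ x (w ∷ʳ b′) | reverse-∷ x w = cong (_∷ʳ x) (reverse-∷ʳ w)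

reverse-frame : ∀ b (u : Vec Bool n) → reverse (frame b u) ≡ frame b (reverse u)
reverse-frame b u = reverse-∷-∷ʳ b b u

opposite-inject₁ : (i : Fin n) → opposite (inject₁ i) ≡ suc (opposite i)
opposite-inject₁ {suc n} zero = refl
opposite-inject₁ {suc n} (suc i) = cong inject₁ (opposite-inject₁ i)

opposite-framePos : (i : Fin n) → opposite (framePos i) ≡ framePos (opposite i)
opposite-framePos i = cong inject₁ (opposite-inject₁ i)

toggle-frame : ∀ b (u : Vec Bool n) i → toggle (frame b u) (framePos i) ≡ frame b (toggle u i)
toggle-frame b u i = cong (b ∷_) (toggle-∷ʳ-inject u b i)

lookup-frame : ∀ b (u : Vec Bool n) i → lookup (frame b u) (framePos i) ≡ lookup u i
lookup-frame b u i = lookup-∷ʳ-inject₁ u b i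

unwrap-word : (u : Vec Bool (suc (suc n))) → reverse u ≡ u →
              Σ Bool λ b → Σ (Vec Bool n) λ u′ → u ≡ frame b u′ × reverse u′ ≡ u′
unwrap-word (b ∷ u₁) e with initLast u₁
... | u′ , b′ , refl with ∷-injective (trans (sym (reverse-∷-∷ʳ b b′ u′)) e)
...   | refl , e′ = b , u′ , refl , proj₁ (∷ʳ-injective (reverse u′) u′ e′)

last-or-inject₁ : (j : Fin (suc n)) → j ≡ fromℕ n ⊎ Σ (Fin n) λ i → j ≡ inject₁ i
last-or-inject₁ {zero} zero = inj₁ refl
last-or-inject₁ {suc n} zero = inj₂ (zero , refl)
last-or-inject₁ {suc n} (suc j) with last-or-inject₁ j
... | inj₁ e = inj₁ (cong suc e)
... | inj₂ (i , e) = inj₂ (suc i , cong suc e)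

unwrap-bit : (i : Fin (suc (suc n))) → opposite i ≡ i →
             Σ (Fin n) λ i′ → i ≡ framePos i′ × opposite i′ ≡ i′
unwrap-bit zero ()
unwrap-bit (suc j) e with last-or-inject₁ j
... | inj₁ refl with trans (sym (cong inject₁ (Fin.opposite-involutive zero))) e
...   | ()
unwrap-bit (suc j) e | inj₂ (i′ , refl) =
  i′ , refl , Fin.inject₁-injective (Fin.suc-injective (trans (sym (opposite-framePos i′)) e))

valid-unwrap : ∀ b (w : Vec Bool n) → Valid (frame b w) → Valid w
valid-unwrap b w t =
  proj₁ (Equivalence.to T-∧ (subst T (noConsec-∷ʳ w b)
    (proj₂ (Equivalence.to T-∧ (subst T (noConsec-∷ b (w ∷ʳ b)) t)))))

valid-∷ʳ-false : (u : Vec Bool n) → Valid u → Valid (u ∷ʳ false)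
valid-∷ʳ-false u t = subst T (sym (trans (noConsec-∷ʳ u false)
  (trans (cong (λ x → noConsec u ∧ not x) (∧-zeroʳ (lastOr u))) (∧-identityʳ _)))) t

valid-∷ʳ-after-false : (u : Vec Bool n) → Valid (u ∷ʳ false) → Valid ((u ∷ʳ false) ∷ʳ true)
valid-∷ʳ-after-false u t = subst T (sym (trans (noConsec-∷ʳ (u ∷ʳ false) true)
  (trans (cong (λ x → noConsec (u ∷ʳ false) ∧ not (x ∧ true)) (lastOr-∷ʳ u false)) (∧-identityʳ _)))) t

-- Fixed codes are the codes of edges in orbits of size one.
Fixed : Code n → Set
Fixed c = reverseCode c ≡ c

valid-frame0 : (u : Vec Bool n) → Valid u → Valid (frame false u)
valid-frame0 u p = valid-false∷ (u ∷ʳ false) (valid-∷ʳ-false u p)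

valid-frame10 : (u : Vec Bool n) → Valid u → Valid (frame true (frame false u))
valid-frame10 u p = valid-false∷ ((u ∷ʳ false) ∷ʳ true) (valid-∷ʳ-after-false u (valid-∷ʳ-false u p))

wrap0 : Code n → Code (suc (suc n))
wrap0 c = code (frame false (low c)) (framePos (bit c)) (valid-frame0 (low c) (low-valid c))
  (trans (lookup-frame false (low c) (bit c)) (bit-clear c))
  (subst Valid (sym (toggle-frame false (low c) (bit c))) (valid-frame0 (toggle (low c) (bit c)) (high-valid c)))

wrap10 : Code n → Code (suc (suc (suc (suc n))))
wrap10 c = code (frame true (low (wrap0 c))) (framePos (bit (wrap0 c))) (valid-frame10 (low c) (low-valid c))
  (trans (lookup-frame true (low (wrap0 c)) (bit (wrap0 c))) (bit-clear (wrap0 c)))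
  (subst Valid (sym (toggle-frame true (low (wrap0 c)) (bit (wrap0 c))))
    (subst (Valid ∘ frame true) (sym (toggle-frame false (low c) (bit c)))
      (valid-frame10 (toggle (low c) (bit c)) (high-valid c))))

-- framing commutes with reversal, so it preserves fixedness
frame-fixed : ∀ b (c : Code n) (d : Code (suc (suc n))) →
              low d ≡ frame b (low c) → bit d ≡ framePos (bit c) → Fixed c → Fixed d
frame-fixed b c d low≡ bit≡ f = code-≡
  (trans (cong reverse low≡) (trans (reverse-frame b (low c)) (trans (cong (frame b ∘ low) f) (sym low≡))))
  (trans (cong opposite bit≡) (trans (opposite-framePos (bit c)) (trans (cong (framePos ∘ bit) f) (sym bit≡))))

wrap0-fixed : (c : Code n) → Fixed c → Fixed (wrap0 c)
wrap0-fixed c = frame-fixed false c (wrap0 c) refl refl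

wrap10-fixed : (c : Code n) → Fixed c → Fixed (wrap10 c)
wrap10-fixed c f = frame-fixed true (wrap0 c) (wrap10 c) refl refl (wrap0-fixed c f)

record Framed (c : Code (suc (suc n))) : Set where
  field
    outer  : Bool
    inner  : Code n
    fixed  : Fixed inner
    low≡   : low c ≡ frame outer (low inner)
    bit≡   : bit c ≡ framePos (bit inner)

unwrap : (c : Code (suc (suc n))) → Fixed c → Framed c
unwrap {n} (code u i p e q) f with unwrap-word u (cong low f) | unwrap-bit i (cong bit f)
... | b , u′ , refl , ru′ | i′ , refl , oi′ = record
  { outer = b ; inner = c′ ; fixed = code-≡ ru′ oi′ ; low≡ = refl ; bit≡ = refl }
  where
  c′ : Code n
  c′ = code u′ i′ (valid-unwrap b u′ p) (trans (sym (lookup-frame b u′ i′)) e)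
         (valid-unwrap b (toggle u′ i′) (subst Valid (toggle-frame b u′ i′) q))

mutual
  palindromes : ∀ n → List (Code n)
  palindromes zero = []
  palindromes (suc zero) = code₁ ∷ []
  palindromes (suc (suc n)) = map wrap0 (palindromes n) ++ framed10 n

  framed10 : ∀ n → List (Code (suc (suc n)))
  framed10 zero = []
  framed10 (suc zero) = []
  framed10 (suc (suc n)) = map wrap10 (palindromes n)

-- the claimed number (n mod 2) F(⌊(n+1)/2⌋) of fixed codes; it satisfies
-- fixedCount (n+4) = fixedCount (n+2) + fixedCount n, like the listing
fixedCount : ℕ → ℕ
fixedCount n = (n % 2) * F ⌊ suc n /2⌋

palindromes-length : ∀ n → length (palindromes n) ≡ fixedCount n
palindromes-length zero = refl
palindromes-length (suc zero) = refl
palindromes-length (suc (suc zero)) = refl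
palindromes-length (suc (suc (suc zero))) = refl
palindromes-length (suc (suc (suc (suc n)))) = begin
  length (map wrap0 (palindromes (suc (suc n))) ++ map wrap10 (palindromes n))
    ≡⟨ length-++ (map wrap0 (palindromes (suc (suc n)))) ⟩
  length (map wrap0 (palindromes (suc (suc n)))) + length (map wrap10 (palindromes n))
    ≡⟨ cong₂ _+_ (length-map wrap0 (palindromes (suc (suc n)))) (length-map wrap10 (palindromes n)) ⟩
  length (palindromes (suc (suc n))) + length (palindromes n)
    ≡⟨ cong₂ _+_ (palindromes-length (suc (suc n))) (palindromes-length n) ⟩
  fixedCount (suc (suc n)) + fixedCount n
    ≡⟨ sym (*-distribˡ-+ (n % 2) (F (suc ⌊ suc n /2⌋)) (F ⌊ suc n /2⌋)) ⟩
  fixedCount (suc (suc (suc (suc n))))  ∎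
  where open ≡-Reasoning

mutual
  palindromes-fixed : ∀ n {c} → c ∈ palindromes n → Fixed c
  palindromes-fixed (suc zero) (here refl) = code-≡ refl refl
  palindromes-fixed (suc (suc n)) m with ∈-++⁻ (map wrap0 (palindromes n)) m
  ... | inj₁ m′ with ∈-map⁻ wrap0 m′
  ...   | c , mc , refl = wrap0-fixed c (palindromes-fixed n mc)
  palindromes-fixed (suc (suc n)) m | inj₂ m′ = framed10-fixed n m′

  framed10-fixed : ∀ n {c} → c ∈ framed10 n → Fixed c
  framed10-fixed (suc (suc n)) m with ∈-map⁻ wrap10 m
  ... | c , mc , refl = wrap10-fixed c (palindromes-fixed n mc)

framed10-head : ∀ n {c} → c ∈ framed10 n → Σ (Vec Bool (suc n)) λ w → low c ≡ true ∷ w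
framed10-head (suc (suc n)) m with ∈-map⁻ wrap10 m
... | _ , _ , refl = _ , refl

frame-injective : ∀ b {u v : Vec Bool n} → frame b u ≡ frame b v → u ≡ v
frame-injective b {u} {v} e = proj₁ (∷ʳ-injective u v (cong Vec.tail e))

framePos-injective : {i j : Fin n} → framePos i ≡ framePos j → i ≡ j
framePos-injective = Fin.inject₁-injective ∘ Fin.suc-injective

wrap0-injective : {c d : Code n} → wrap0 c ≡ wrap0 d → c ≡ d
wrap0-injective e = code-≡ (frame-injective false (cong low e)) (framePos-injective (cong bit e))

wrap10-injective : {c d : Code n} → wrap10 c ≡ wrap10 d → c ≡ d
wrap10-injective e = wrap0-injective (code-≡ (frame-injective true (cong low e)) (framePos-injective (cong bit e)))

mutual
  palindromes-unique : ∀ n → Unique (palindromes n)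
  palindromes-unique zero = []
  palindromes-unique (suc zero) = [] ∷ []
  palindromes-unique (suc (suc n)) =
    Uniqueₚ.++⁺ (Uniqueₚ.map⁺ wrap0-injective (palindromes-unique n)) (framed10-unique n) disjoint
    where
    disjoint : ∀ {c} → c ∈ map wrap0 (palindromes n) × c ∈ framed10 n → ⊥
    disjoint (m , m′) with ∈-map⁻ wrap0 m | framed10-head n m′
    ... | _ , _ , refl | _ , ()

  framed10-unique : ∀ n → Unique (framed10 n)
  framed10-unique zero = []
  framed10-unique (suc zero) = []
  framed10-unique (suc (suc n)) = Uniqueₚ.map⁺ wrap10-injective (palindromes-unique n)

-- A fixed code framed by 1 … 1 has an inner code framed by 0 … 0, since
-- 11 is forbidden; so it is listed in framed10.
framed10-complete : ∀ n (c : Code (suc (suc n))) (fr : Framed c) →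
                    Framed.inner fr ∈ palindromes n → Framed.outer fr ≡ true → c ∈ framed10 n
framed10-complete (suc zero) c fr _ refl =
  ⊥-elim (subst (λ d → Valid (toggle (frame true (low d)) (framePos (bit d)))) (code₁-unique inner code₁)
            (subst₂ (λ u i → Valid (toggle u i)) low≡ bit≡ (high-valid c)))
  where open Framed fr
framed10-complete (suc (suc n)) c fr m refl with ∈-++⁻ (map wrap0 (palindromes n)) m
  where open Framed fr
... | inj₁ m′ with ∈-map⁻ wrap0 m′
...   | c″ , mc″ , e = subst (_∈ framed10 (suc (suc n))) (sym c≡) (∈-map⁺ wrap10 mc″)
  where
  open Framed fr
  c≡ : c ≡ wrap10 c″
  c≡ = code-≡ (trans low≡ (cong (frame true ∘ low) e)) (trans bit≡ (cong (framePos ∘ bit) e))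
framed10-complete (suc (suc n)) c fr m refl | inj₂ m′ with framed10-head n m′
... | w , head≡ = ⊥-elim (subst Valid (trans low≡ (cong (frame true) head≡)) (low-valid c))
  where open Framed fr

palindromes-complete : ∀ n (c : Code n) → Fixed c → c ∈ palindromes n
palindromes-complete (suc zero) c _ = here (code₁-unique c code₁)
palindromes-complete (suc (suc n)) c f with unwrap c f
... | fr with Framed.outer fr in outer≡
...   | true = ∈-++⁺ʳ (map wrap0 (palindromes n)) (framed10-complete n c fr inner∈ outer≡)
  where
  inner∈ : Framed.inner fr ∈ palindromes n
  inner∈ = palindromes-complete n (Framed.inner fr) (Framed.fixed fr)
...   | false = ∈-++⁺ˡ (subst (_∈ map wrap0 (palindromes n)) (sym c≡) (∈-map⁺ wrap0 inner∈))
  where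
  open Framed fr
  inner∈ : inner ∈ palindromes n
  inner∈ = palindromes-complete n inner fixed
  c≡ : c ≡ wrap0 inner
  c≡ = code-≡ (trans low≡ (cong (λ b → frame b (low inner)) outer≡)) bit≡

edgeCount-formula : ∀ n → 5 * edgeCount n ≡ n * F (suc n) + 2 * (suc n * F n)
edgeCount-formula zero = refl
edgeCount-formula (suc zero) = refl
edgeCount-formula (suc (suc n)) = begin
  5 * (x + (y + (a + b)))
    ≡⟨ solve 4 (λ x y a b → con 5 :* (x :+ (y :+ (a :+ b))) := con 5 :* x :+ (con 5 :* y :+ con 5 :* (a :+ b)))
               refl x y a b ⟩
  5 * x + (5 * y + 5 * (a + b))
    ≡⟨ cong₂ (λ p q → p + (q + 5 * (a + b))) (edgeCount-formula (suc n)) (edgeCount-formula n) ⟩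
  suc n * (a + b) + 2 * (suc (suc n) * a) + (n * a + 2 * (suc n * b) + 5 * (a + b))
    ≡⟨ solve 3 (λ n a b → (con 1 :+ n) :* (a :+ b) :+ con 2 :* ((con 2 :+ n) :* a)
                           :+ (n :* a :+ con 2 :* ((con 1 :+ n) :* b) :+ con 5 :* (a :+ b))
                         := (con 2 :+ n) :* ((a :+ b) :+ a) :+ con 2 :* ((con 3 :+ n) :* (a :+ b))) refl n a b ⟩
  suc (suc n) * ((a + b) + a) + 2 * (suc (suc (suc n)) * (a + b))  ∎
  where
  open ≡-Reasoning
  open +-*-Solver
  x y a b : ℕ
  x = edgeCount (suc n)
  y = edgeCount n
  a = F (suc n)
  b = F n

orbit-arithmetic : ∀ f r e S → f + 2 * r ≡ e → 5 * e ≡ S →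
                   10 * r + 5 * f ≡ S × 10 * (f + r) ≡ S + 5 * f
orbit-arithmetic f r e S f+2r≡e 5e≡S =
  trans (solve 2 (λ f r → con 10 :* r :+ con 5 :* f := con 5 :* (f :+ con 2 :* r)) refl f r) 5[f+2r]≡S ,
  trans (solve 2 (λ f r → con 10 :* (f :+ r) := con 5 :* (f :+ con 2 :* r) :+ con 5 :* f) refl f r)
        (cong (_+ 5 * f) 5[f+2r]≡S)
  where
  open +-*-Solver
  5[f+2r]≡S : 5 * (f + 2 * r) ≡ S
  5[f+2r]≡S = trans (cong (5 *_) f+2r≡e) 5e≡S

theorem4p3 : (n : ℕ) →
    OEk (ΓV n) (ΓAdj n) 1 ((n % 2) * F ⌊ suc n /2⌋)
    × Σ ℕ (λ m → OEk (ΓV n) (ΓAdj n) 2 m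
    × 10 * m + 5 * ((n % 2) * F ⌊ suc n /2⌋) ≡ n * F (suc n) + 2 * ((suc n) * F n))
    × Σ ℕ (λ m → OE (ΓV n) (ΓAdj n) m
    × 10 * m ≡ n * F (suc n) + 2 * ((suc n) * F n) + 5 * ((n % 2) * F ⌊ suc n /2⌋))
theorem4p3 n =
  subst (OEk (ΓV n) (ΓAdj n) 1) |Fix| orbits-size1 ,
  (length Rep , orbits-size2 , subst (λ f → 10 * length Rep + 5 * f ≡ S) |Fix| (proj₁ counts)) ,
  (length Fix + length Rep , orbits-all ,
   subst (λ f → 10 * (length Fix + length Rep) ≡ S + 5 * f) |Fix| (proj₂ counts))
  where
  open OrbitsFromCoding _≟ᶜ_ reverseCode reverseCode-involutive edgeOf edge-code edgeOf-injective
                        orbit-partner orbit-sound (codes n) (codes-unique n) (codes-complete n)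
  |Fix| : length Fix ≡ fixedCount n
  |Fix| = trans (Fix-length (palindromes-unique n) (mk⇔ (palindromes-fixed n) (palindromes-complete n _)))
                (palindromes-length n)
  S : ℕ
  S = n * F (suc n) + 2 * (suc n * F n)
  counts : 10 * length Rep + 5 * length Fix ≡ S × 10 * (length Fix + length Rep) ≡ S + 5 * length Fix
  counts = orbit-arithmetic (length Fix) (length Rep) (edgeCount n) S
             (trans (sym orbit-count) (codes-length n)) (edgeCount-formula n)
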